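{- Let $k\ge 2$ be an integer and let $G$ be a finite simple graph with a Hamilton cycle $C$. Suppose that for some vertex set $A\subseteq V(G)$ with $|A|=k$, the subgraph $G-A$ has exactly $k$ components $H_1,H_2,\dots,H_k$, each of which is a path, and the endpoints of $H_i$ have odd degree in $G$ for every $i\in\{1,\dots,k-1\}$. Then (1) for every Hamilton cycle $C'$ of $G$, $C'-A=C-A$; and (2) each edge of $G-E(H_k)$ incident to an endpoint of $H_k$ is contained in an even number of Hamilton cycles of $G$.
   Context: For a subgraph $F$ and vertex set $A$, $F-A$ denotes the subgraph obtained by deleting the vertices of $A$ (and incident edges); $G-E(H_k)$ denotes $G$ with the edges of $H_k$ removed. -}

module Defs where

open import Data.Nat using (ℕ; zero; suc; _+_; _*_; _≤_)
open import Data.Fin using (Fin; toℕ; fromℕ) renaming (zero to fzero)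
open import Data.Bool using (Bool; true; false; if_then_else_)
open import Data.Vec using (Vec; lookup)
open import Data.List using (List; length; map; allFin)
open import Data.Nat.ListAction using (sum)
open import Data.List.Membership.Propositional using (_∈_)
open import Data.List.Relation.Unary.Unique.Propositional using (Unique)
open import Data.Product using (Σ; ∃; ∃-syntax; _×_; _,_)
open import Data.Sum using (_⊎_)
open import Relation.Nullary using (¬_)
open import Relation.Binary.PropositionalEquality using (_≡_; _≢_)
open import Function.Bundles using (_⇔_)
open import Function.Definitions using (Injective)

Even : ℕ → Set
Even m = ∃[ t ] (m ≡ 2 * t)

Odd : ℕ → Set
Odd m = ∃[ t ] (m ≡ suc (2 * t))

record Graph : Set where
  field
    n      : ℕ
    adj    : Fin n → Fin n → Bool
    sym    : ∀ u v → adj u v ≡ adj v u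
    irrefl : ∀ v → adj v v ≡ false

module _ (G : Graph) where
  open Graph G

  E : Fin n → Fin n → Set
  E u v = adj u v ≡ true

  deg : Fin n → ℕ
  deg v = sum (map (λ u → if adj v u then 1 else 0) (allFin n))

  -- A spanning edge set, represented by its (Bool) adjacency matrix.
  -- Vec-of-Vec so that _≡_ is extensional equality of edge sets.
  EdgeSet : Set
  EdgeSet = Vec (Vec Bool n) n

  InE : EdgeSet → Fin n → Fin n → Set
  InE M u v = lookup (lookup M u) v ≡ true

  CycConsec : (Fin n → Fin n) → Fin n → Fin n → Set
  CycConsec σ u v = ∃[ i ] ∃[ j ] (u ≡ σ i × v ≡ σ j ×
                      (suc (toℕ i) ≡ toℕ j ⊎ (suc (toℕ i) ≡ n × toℕ j ≡ 0)))

  HamCycle : EdgeSet → Set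
  HamCycle M = 3 ≤ n × Σ (Fin n → Fin n) λ σ → Injective _≡_ _≡_ σ ×
                 (∀ u v → InE M u v ⇔ (CycConsec σ u v ⊎ CycConsec σ v u)) ×
                 (∀ u v → InE M u v → E u v)

  EvenlyManyHamCyclesThrough : Fin n → Fin n → Set
  EvenlyManyHamCyclesThrough u v =
    ∃[ L ] (Unique L × (∀ M → (M ∈ L) ⇔ (HamCycle M × InE M u v)) × Even (length L))

  -- Data describing that G - A has exactly k components H_0,…,H_{k-1}, each a path:
  -- H_i has vertices p i 0, …, p i (len i) (in path order).
  record PathComponents (k : ℕ) (A : Fin k → Fin n) : Set where
    field
      len : Fin k → ℕ
      p   : (i : Fin k) → Fin (suc (len i)) → Fin n
      p-inj    : ∀ i a j b → p i a ≡ p j b → i ≡ j × toℕ a ≡ toℕ b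
      p-notA   : ∀ i a t → p i a ≢ A t
      p-cover  : ∀ v → (∀ t → v ≢ A t) → ∃[ i ] ∃[ a ] (p i a ≡ v)
      -- inside H_i, G-adjacency is exactly path-consecutiveness (so H_i is an induced path)
      p-path   : ∀ i a b → E (p i a) (p i b) ⇔ (suc (toℕ a) ≡ toℕ b ⊎ suc (toℕ b) ≡ toℕ a)
      p-noedge : ∀ i j a b → i ≢ j → ¬ E (p i a) (p j b)

    IsEndpoint : Fin k → Fin n → Set
    IsEndpoint i u = u ≡ p i fzero ⊎ u ≡ p i (fromℕ (len i))

    PathEdge : Fin k → Fin n → Fin n → Set
    PathEdge i u v = ∃[ a ] ∃[ b ] (u ≡ p i a × v ≡ p i b ×
                       (suc (toℕ a) ≡ toℕ b ⊎ suc (toℕ b) ≡ toℕ a))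

-- Let f₀, …, f₍ₙ₋₁₎ be a Hamilton path with f₀ ∈ A. Of its n − 1 consecutive pairs at most 2k − 1 meet A,
-- and every other pair is an edge of G − A, hence an edge of one of the paths H_j, different pairs giving
-- different edges. The H_j have n − 2k edges in total, so equality holds throughout: f₍ₙ₋₁₎ ∉ A and f runs
-- through every edge of every H_j. Reading a Hamilton cycle from a vertex of A thus shows that its edges
-- outside A are exactly those of the H_j, which is (1).
--
-- For (2), the other end v of the edge lies in A, and Hamilton cycles through uv correspond to Hamilton
-- paths v, u, …, z with zv ∈ E. Such a path first runs through H_k, so by the above z is an endpoint of an
-- earlier H_j and has odd degree. Thomason's lollipop argument then applies: besides its predecessor, z
-- has an even number of neighbours; v is one of them exactly when the path closes up, and every other one,
-- at position p, gives the Pósa rotation v, u, …, f_p, z, …, f₍ₚ₊₁₎. Rotation is an involution without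
-- fixed points on these (path, position) pairs, so the number of closing paths is even.

module Submission where

open import Defs
open import Data.Nat using (ℕ; zero; suc; _+_; _*_; _∸_; _⊓_; _≤_; _<_; z≤n; s≤s; s≤s⁻¹; NonZero; >-nonZero)
open import Data.Nat.Properties
open import Data.Nat.DivMod using (_%_; _/_; _mod_; m%n<n; m<n⇒m%n≡m; m%n%n≡m%n; %-distribˡ-+;
  [m+kn]%n≡m%n; [m+n]%n≡m%n; m≡m%n+[m/n]*n; n%n≡0; %-congˡ)
open import Data.Nat.Solver using (module +-*-Solver)
open import Data.Nat.ListAction using () renaming (sum to sumˡ)
open import Data.Bool using (Bool; true; false; if_then_else_)
import Data.Bool.Properties as Boolₚ
open import Data.Fin using (Fin; zero; suc; toℕ; fromℕ; fromℕ<; inject₁; punchOut; opposite)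
open import Data.Fin.Properties using (any?; all?; toℕ-injective; toℕ<n; toℕ-fromℕ; toℕ-fromℕ<; toℕ-inject₁;
  toℕ≤pred[n]; toℕ≤pred[n]′; punchOut-injective; injective⇒≤; opposite-prop; opposite-involutive)
  renaming (_≟_ to _≟ᶠ_)
import Data.Fin.Properties as Finₚ
open import Data.Fin.Permutation using (permutation)
open import Algebra.Properties.CommutativeMonoid.Sum +-0-commutativeMonoid
  using (sum-syntax; sum-cong-≗; sum-init-last; ∑-distrib-+; ∑-comm; ∑-permute)
open import Algebra.Properties.CommutativeSemigroup +-commutativeSemigroup using (interchange; x∙yz≈y∙xz)
open import Data.List using (List; []; _∷_; map; filter; length; allFin; cartesianProductWith)
import Data.List as List
import Data.List.Properties as Listₚ
open import Data.List.Membership.Propositional using (_∈_)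
open import Data.List.Membership.Propositional.Properties
  using (∈-filter⁺; ∈-filter⁻; ∈-map⁺; ∈-map⁻; ∈-cartesianProductWith⁺; ∈-allFin)
open import Data.List.Relation.Unary.Any using (here; there)
open import Data.List.Relation.Unary.All as All using (All)
import Data.List.Relation.Unary.All.Properties as AllP
open import Data.List.Relation.Unary.AllPairs using ([]; _∷_)
open import Data.List.Relation.Unary.Unique.Propositional using (Unique)
open import Data.List.Relation.Unary.Unique.Propositional.Properties
  using (filter⁺; allFin⁺; cartesianProductWith⁺)
open import Data.Vec using (Vec; []; _∷_; lookup; tabulate)
import Data.Vec.Properties as Vecₚ
open import Data.Product using (Σ; ∃; ∃₂; _×_; _,_; proj₁; proj₂)
open import Data.Sum as Sum using (_⊎_; inj₁; inj₂; [_,_]; swap)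
open import Function using (_∘_; id)
open import Function.Definitions using (Injective)
open import Function.Bundles using (_⇔_; mk⇔; Equivalence)
open import Function.Properties.Equivalence using () renaming (trans to ⇔-trans; sym to ⇔-sym)
open import Relation.Binary.Definitions using (DecidableEquality)
open import Relation.Nullary using (Dec; yes; no; does; ¬_; ¬?; contradiction)
open import Relation.Nullary.Decidable using (_×-dec_; _⊎-dec_; _→-dec_; map′)
open import Relation.Binary.PropositionalEquality
  using (_≡_; _≢_; refl; sym; trans; cong; cong₂; subst; subst₂; module ≡-Reasoning)

𝟙 : ∀ {p} {P : Set p} → Dec P → ℕ
𝟙 (yes _) = 1
𝟙 (no _)  = 0

module _ {p} {P : Set p} where

  𝟙-yes : (d : Dec P) → P → 𝟙 d ≡ 1
  𝟙-yes (yes _) _  = refl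
  𝟙-yes (no ¬x) x  = contradiction x ¬x

  𝟙-no : (d : Dec P) → ¬ P → 𝟙 d ≡ 0
  𝟙-no (yes x) ¬x = contradiction x ¬x
  𝟙-no (no _)  _  = refl

  𝟙≡1⇒ : (d : Dec P) → 𝟙 d ≡ 1 → P
  𝟙≡1⇒ (yes x) _  = x
  𝟙≡1⇒ (no _)  ()

𝟙-mono : ∀ {p q} {P : Set p} {Q : Set q} → (P → Q) → (d : Dec P) (e : Dec Q) → 𝟙 d ≤ 𝟙 e
𝟙-mono P⇒Q (yes x) e = ≤-reflexive (sym (𝟙-yes e (P⇒Q x)))
𝟙-mono P⇒Q (no _)  e = z≤n

𝟙-cong : ∀ {p q} {P : Set p} {Q : Set q} → (P → Q) → (Q → P) → (d : Dec P) (e : Dec Q) → 𝟙 d ≡ 𝟙 e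
𝟙-cong P⇒Q Q⇒P d e = ≤-antisym (𝟙-mono P⇒Q d e) (𝟙-mono Q⇒P e d)

∀<? : ∀ {p} {P : ℕ → Set p} → (∀ i → Dec (P i)) → ∀ n → Dec (∀ {i} → i < n → P i)
∀<? {P = P} P? n = map′ (λ ∀P {i} i<n → subst P (toℕ-fromℕ< i<n) (∀P (fromℕ< i<n)))
                        (λ ∀P i → ∀P (toℕ<n i))
                        (all? (P? ∘ toℕ))

∑-const : ∀ n c → ∑[ i < n ] c ≡ n * c
∑-const zero    c = refl
∑-const (suc n) c = cong (c +_) (∑-const n c)

∑-zero : ∀ {n} {f : Fin n → ℕ} → (∀ i → f i ≡ 0) → ∑[ i < n ] f i ≡ 0
∑-zero {n} f≡0 = trans (sum-cong-≗ f≡0) (trans (∑-const n 0) (*-zeroʳ n))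

∑-mono-≤ : ∀ {n} {f g : Fin n → ℕ} → (∀ i → f i ≤ g i) → ∑[ i < n ] f i ≤ ∑[ i < n ] g i
∑-mono-≤ {zero}  _   = z≤n
∑-mono-≤ {suc n} f≤g = +-mono-≤ (f≤g zero) (∑-mono-≤ (f≤g ∘ suc))

∑-mono-≤-equality : ∀ {n} {f g : Fin n → ℕ} → (∀ i → f i ≤ g i) →
                    ∑[ i < n ] g i ≤ ∑[ i < n ] f i → ∀ i → f i ≡ g i
∑-mono-≤-equality {suc n} {f} {g} f≤g ∑g≤∑f = pointwise
  where
  head≡ : f zero ≡ g zero
  head≡ = ≤-antisym (f≤g zero)
    (+-cancelʳ-≤ _ _ _ (≤-trans ∑g≤∑f (+-monoʳ-≤ (f zero) (∑-mono-≤ (f≤g ∘ suc)))))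
  pointwise : ∀ i → f i ≡ g i
  pointwise zero    = head≡
  pointwise (suc i) = ∑-mono-≤-equality (f≤g ∘ suc)
    (+-cancelˡ-≤ (g zero) _ _ (subst (λ x → g zero + _ ≤ x + _) head≡ ∑g≤∑f)) i

∑-distrib-+₄ : ∀ {n} (w x y z : Fin n → ℕ) →
               ∑[ i < n ] (w i + x i + y i + z i) ≡ ∑[ i < n ] w i + ∑[ i < n ] x i + ∑[ i < n ] y i + ∑[ i < n ] z i
∑-distrib-+₄ w x y z = trans (∑-distrib-+ _ z) (cong (_+ _) (trans (∑-distrib-+ _ y) (cong (_+ _) (∑-distrib-+ w x))))

∑-cong-bound : ∀ {m m′} (g : ℕ → ℕ) → m ≡ m′ → ∑[ i < m ] g (toℕ i) ≡ ∑[ i < m′ ] g (toℕ i)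
∑-cong-bound g refl = refl

∑-last : ∀ m (g : ℕ → ℕ) → ∑[ i < suc m ] g (toℕ i) ≡ ∑[ i < m ] g (toℕ i) + g m
∑-last m g = trans (sum-init-last {m} (g ∘ toℕ))
  (cong₂ _+_ (sum-cong-≗ {m} (cong g ∘ toℕ-inject₁)) (cong g (toℕ-fromℕ m)))

sumˡ-allFin : ∀ n (h : Fin n → ℕ) → sumˡ (map h (allFin n)) ≡ ∑[ i < n ] h i
sumˡ-allFin n h = trans (cong sumˡ (Listₚ.map-tabulate id h)) (sumˡ-tabulate n h)
  where
  sumˡ-tabulate : ∀ n (h : Fin n → ℕ) → sumˡ (List.tabulate h) ≡ ∑[ i < n ] h i
  sumˡ-tabulate zero    h = refl
  sumˡ-tabulate (suc n) h = cong (h zero +_) (sumˡ-tabulate n (h ∘ suc))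

∑-𝟙-≟ : ∀ {n} (w : Fin n) → ∑[ v < n ] 𝟙 (w ≟ᶠ v) ≡ 1
∑-𝟙-≟ {suc n} zero    = cong suc (∑-zero {n} (λ v → 𝟙-no (zero ≟ᶠ suc v) λ ()))
∑-𝟙-≟ {suc n} (suc w) =
  trans (sum-cong-≗ (λ v → 𝟙-cong Finₚ.suc-injective (cong suc) (suc w ≟ᶠ suc v) (w ≟ᶠ v))) (∑-𝟙-≟ w)

∑-𝟙-image : ∀ {m n} (g : Fin m → Fin n) → Injective _≡_ _≡_ g →
            ∑[ v < n ] 𝟙 (any? (λ t → g t ≟ᶠ v)) ≡ m
∑-𝟙-image {m} {n} g g-inj = begin
  ∑[ v < n ] 𝟙 (any? (λ t → g t ≟ᶠ v))   ≡⟨ sum-cong-≗ preimages ⟩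
  ∑[ v < n ] ∑[ t < m ] 𝟙 (g t ≟ᶠ v)      ≡⟨ ∑-comm (λ v t → 𝟙 (g t ≟ᶠ v)) ⟩
  ∑[ t < m ] ∑[ v < n ] 𝟙 (g t ≟ᶠ v)      ≡⟨ sum-cong-≗ (∑-𝟙-≟ ∘ g) ⟩
  ∑[ t < m ] 1                            ≡⟨ trans (∑-const m 1) (*-identityʳ m) ⟩
  m                                       ∎
  where
  open ≡-Reasoning
  preimages : ∀ v → 𝟙 (any? (λ t → g t ≟ᶠ v)) ≡ ∑[ t < m ] 𝟙 (g t ≟ᶠ v)
  preimages v with any? (λ t → g t ≟ᶠ v)
  ... | yes (s , gs≡v) = sym (trans
          (sum-cong-≗ (λ t → 𝟙-cong (λ gt≡v → g-inj (trans gs≡v (sym gt≡v))) (λ { refl → gs≡v })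
                                     (g t ≟ᶠ v) (s ≟ᶠ t)))
          (∑-𝟙-≟ s))
  ... | no ∄ = sym (∑-zero (λ t → 𝟙-no (g t ≟ᶠ v) (λ gt≡v → ∄ (t , gt≡v))))

injective⇒surjective : ∀ {n} {σ : Fin n → Fin n} → Injective _≡_ _≡_ σ → ∀ v → ∃ λ i → σ i ≡ v
injective⇒surjective {suc m} {σ} σ-inj v with any? (λ i → σ i ≟ᶠ v)
... | yes found = found
... | no ∄ = contradiction (injective⇒≤ punched-inj) (<-irrefl refl)
  where
  v≢σ : ∀ i → v ≢ σ i
  v≢σ i v≡σi = ∄ (i , sym v≡σi)
  punched-inj : Injective _≡_ _≡_ (λ i → punchOut (v≢σ i))
  punched-inj eq = σ-inj (punchOut-injective (v≢σ _) (v≢σ _) eq)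

∑-reindex : ∀ {n} {σ : Fin n → Fin n} → Injective _≡_ _≡_ σ →
            (h : Fin n → ℕ) → ∑[ v < n ] h v ≡ ∑[ i < n ] h (σ i)
∑-reindex {n} {σ} σ-inj h = ∑-permute h (permutation σ σ⁻¹ (proj₂ ∘ surj) (λ i → σ-inj (proj₂ (surj (σ i)))))
  where
  surj : ∀ v → ∃ λ i → σ i ≡ v
  surj = injective⇒surjective σ-inj
  σ⁻¹ : Fin n → Fin n
  σ⁻¹ = proj₁ ∘ surj

even-+ : ∀ {a b} → Even a → Even b → Even (a + b)
even-+ (s , refl) (t , refl) = s + t , sym (*-distribˡ-+ 2 s t)

even-cancelʳ : ∀ a {b} → Even (a + b) → Even b → Even a
even-cancelʳ a {b} (s , a+b≡2s) (t , refl) = s ∸ t , (begin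
  a                    ≡⟨ m+n∸n≡m a (2 * t) ⟨
  a + 2 * t ∸ 2 * t    ≡⟨ cong (_∸ 2 * t) a+b≡2s ⟩
  2 * s ∸ 2 * t        ≡⟨ *-distribˡ-∸ 2 s t ⟨
  2 * (s ∸ t)          ∎)
  where open ≡-Reasoning

even-suc-suc : ∀ {a} → Even a → Even (suc (suc a))
even-suc-suc (t , refl) = suc t , cong suc (sym (+-suc t (t + 0)))

odd-suc⇒even : ∀ {a} → Odd (suc a) → Even a
odd-suc⇒even (t , eq) = t , suc-injective eq

∑-even : ∀ {n} {f : Fin n → ℕ} → (∀ i → Even (f i)) → Even (∑[ i < n ] f i)
∑-even {zero}  _ = 0 , refl
∑-even {suc n} f-even = even-+ (f-even zero) (∑-even (λ i → f-even (suc i)))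

module _ {X : Set} where

  sumˡ-map-+ : ∀ (xs : List X) (g h : X → ℕ) →
               sumˡ (map (λ x → g x + h x) xs) ≡ sumˡ (map g xs) + sumˡ (map h xs)
  sumˡ-map-+ []       g h = refl
  sumˡ-map-+ (x ∷ xs) g h = trans (cong (g x + h x +_) (sumˡ-map-+ xs g h)) (interchange (g x) (h x) _ _)

  sumˡ-map-∑ : ∀ (xs : List X) {n} (F : Fin n → X → ℕ) →
               sumˡ (map (λ x → ∑[ i < n ] F i x) xs) ≡ ∑[ i < n ] sumˡ (map (F i) xs)
  sumˡ-map-∑ []       {n} F = sym (∑-zero {n} (λ _ → refl))
  sumˡ-map-∑ (x ∷ xs) F =
    trans (cong (∑[ i < _ ] F i x +_) (sumˡ-map-∑ xs F)) (sym (∑-distrib-+ (λ i → F i x) _))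

  sumˡ-even : ∀ (xs : List X) {h : X → ℕ} → (∀ {x} → x ∈ xs → Even (h x)) → Even (sumˡ (map h xs))
  sumˡ-even []       _      = 0 , refl
  sumˡ-even (x ∷ xs) h-even = even-+ (h-even (here refl)) (sumˡ-even xs (h-even ∘ there))

  length-filter : ∀ {P : X → Set} (P? : ∀ x → Dec (P x)) xs →
                  length (filter P? xs) ≡ sumˡ (map (λ x → 𝟙 (P? x)) xs)
  length-filter P? [] = refl
  length-filter P? (x ∷ xs) with P? x
  ... | yes _ = cong suc (length-filter P? xs)
  ... | no  _ = length-filter P? xs

  allVecs : List X → ∀ n → List (Vec X n)
  allVecs xs zero    = List.[ [] ]
  allVecs xs (suc n) = cartesianProductWith _∷_ xs (allVecs xs n)

  ∈-allVecs : ∀ {xs} → (∀ x → x ∈ xs) → ∀ {n} (v : Vec X n) → v ∈ allVecs xs n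
  ∈-allVecs ∈xs []      = here refl
  ∈-allVecs ∈xs (x ∷ v) = ∈-cartesianProductWith⁺ _∷_ (∈xs x) (∈-allVecs ∈xs v)

  allVecs-unique : ∀ {xs} → Unique xs → ∀ n → Unique (allVecs xs n)
  allVecs-unique xs! zero    = All.[] ∷ []
  allVecs-unique xs! (suc n) = cartesianProductWith⁺ _∷_ Vecₚ.∷-injective xs! (allVecs-unique xs! n)

  module _ (_≟_ : DecidableEquality X) where

    length-remove : ∀ {xs} → Unique xs → ∀ {y} → y ∈ xs →
                    length xs ≡ suc (length (filter (λ x → ¬? (x ≟ y)) xs))
    length-remove {x ∷ xs} (x∉xs ∷ _) (here refl) =
      cong suc (sym (cong length (trans (Listₚ.filter-reject (λ z → ¬? (z ≟ x)) (λ x≢x → x≢x refl))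
                                        (Listₚ.filter-all (λ z → ¬? (z ≟ x)) (All.map ≢-sym x∉xs)))))
      where
      ≢-sym : ∀ {z} → x ≢ z → z ≢ x
      ≢-sym x≢z z≡x = x≢z (sym z≡x)
    length-remove {x ∷ xs} (x∉xs ∷ xs!) {y} (there y∈xs) =
      trans (cong suc (length-remove xs! y∈xs))
            (cong (suc ∘ length) (sym (Listₚ.filter-accept (λ z → ¬? (z ≟ y)) (All.lookup x∉xs y∈xs))))

    involution⇒even-length : (ι : X → X) → (∀ x → ι (ι x) ≡ x) → ∀ {xs} → Unique xs →
                             (∀ {x} → x ∈ xs → ι x ∈ xs) → (∀ {x} → x ∈ xs → ι x ≢ x) →
                             Even (length xs)
    involution⇒even-length ι ιι≡id {xs} = go (length xs) ≤-refl
      where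
      go : ∀ N {xs} → length xs ≤ N → Unique xs →
           (∀ {x} → x ∈ xs → ι x ∈ xs) → (∀ {x} → x ∈ xs → ι x ≢ x) → Even (length xs)
      go _       {[]}     _        _            _      _       = 0 , refl
      go (suc N) {x ∷ xs} (s≤s ≤N) (x∉xs ∷ xs′!) closed no-fixed =
        subst Even (sym (cong suc (length-remove xs′! ιx∈xs)))
              (even-suc-suc (go N {ys} ys≤N (filter⁺ _ xs′!) ys-closed ys-no-fixed))
        where
        ιx∈xs : ι x ∈ xs
        ιx∈xs with closed (here refl)
        ... | here ιx≡x  = contradiction ιx≡x (no-fixed (here refl))
        ... | there ιx∈  = ιx∈
        ys : List X
        ys = filter (λ z → ¬? (z ≟ ι x)) xs
        ys-closed : ∀ {y} → y ∈ ys → ι y ∈ ys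
        ys-closed {y} y∈ys with ∈-filter⁻ (λ z → ¬? (z ≟ ι x)) {xs = xs} y∈ys
        ... | y∈xs , y≢ιx with closed (there y∈xs)
        ...   | here ιy≡x   = contradiction (trans (sym (ιι≡id y)) (cong ι ιy≡x)) y≢ιx
        ...   | there ιy∈xs = ∈-filter⁺ (λ z → ¬? (z ≟ ι x)) ιy∈xs
                  (λ ιy≡ιx → All.lookup x∉xs y∈xs
                               (sym (trans (sym (ιι≡id y)) (trans (cong ι ιy≡ιx) (ιι≡id x)))))
        ys≤N : length ys ≤ N
        ys≤N = ≤-trans (n≤1+n _) (≤-trans (≤-reflexive (sym (length-remove xs′! ιx∈xs))) ≤N)
        ys-no-fixed : ∀ {y} → y ∈ ys → ι y ≢ y
        ys-no-fixed y∈ys = no-fixed (there (proj₁ (∈-filter⁻ (λ z → ¬? (z ≟ ι x)) {xs = xs} y∈ys)))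

module _ {X : Set} (default : X) where

  lookupℕ : ∀ {m} → Vec X m → ℕ → X
  lookupℕ []       _       = default
  lookupℕ (x ∷ xs) zero    = x
  lookupℕ (x ∷ xs) (suc t) = lookupℕ xs t

  lookupℕ-toℕ : ∀ {m} (xs : Vec X m) i → lookupℕ xs (toℕ i) ≡ lookup xs i
  lookupℕ-toℕ (x ∷ xs) zero    = refl
  lookupℕ-toℕ (x ∷ xs) (suc i) = lookupℕ-toℕ xs i

  lookupℕ-tabulate : ∀ {m} (g : Fin m → X) {t} (t<m : t < m) → lookupℕ (tabulate g) t ≡ g (fromℕ< t<m)
  lookupℕ-tabulate {suc m} g {zero}  _         = refl
  lookupℕ-tabulate {suc m} g {suc t} (s≤s t<m) = lookupℕ-tabulate (g ∘ suc) t<m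

map-unique : ∀ {X Y : Set} (f : X → Y) {xs : List X} → (∀ {x y} → x ∈ xs → y ∈ xs → f x ≡ f y → x ≡ y) →
             Unique xs → Unique (map f xs)
map-unique f {[]}     _     _            = []
map-unique f {x ∷ xs} f-inj (x∉xs ∷ xs!) =
  AllP.map⁺ (All.tabulate (λ y∈xs fx≡fy → All.lookup x∉xs y∈xs (f-inj (here refl) (there y∈xs) fx≡fy)))
  ∷ map-unique f (λ x∈ y∈ → f-inj (there x∈) (there y∈)) xs!

Vec-ext : ∀ {X : Set} {m} {v w : Vec X m} → (∀ i → lookup v i ≡ lookup w i) → v ≡ w
Vec-ext {v = v} {w} v≗w =
  trans (sym (Vecₚ.tabulate∘lookup v)) (trans (Vecₚ.tabulate-cong v≗w) (Vecₚ.tabulate∘lookup w))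

≡true-ext : ∀ {b c : Bool} → (b ≡ true ⇔ c ≡ true) → b ≡ c
≡true-ext {false} {false} _   = refl
≡true-ext {false} {true}  b⇔c = Equivalence.from b⇔c refl
≡true-ext {true}  {false} b⇔c = sym (Equivalence.to b⇔c refl)
≡true-ext {true}  {true}  _   = refl

does⇔ : ∀ {p} {P : Set p} (d : Dec P) → (does d ≡ true) ⇔ P
does⇔ (yes x) = mk⇔ (λ _ → x) (λ _ → refl)
does⇔ (no ¬x) = mk⇔ (λ ()) (λ x → contradiction x ¬x)

-- Cyclic orders

module _ {n : ℕ} .{{_ : NonZero n}} where

  %-cong-+ˡ : ∀ c {a b} → a % n ≡ b % n → (c + a) % n ≡ (c + b) % n
  %-cong-+ˡ c {a} {b} eq = begin
    (c + a) % n              ≡⟨ %-distribˡ-+ c a n ⟩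
    (c % n + a % n) % n      ≡⟨ cong (λ x → (c % n + x) % n) eq ⟩
    (c % n + b % n) % n      ≡⟨ %-distribˡ-+ c b n ⟨
    (c + b) % n              ∎
    where open ≡-Reasoning

  suc-% : ∀ t → suc t % n ≡ suc (t % n) % n
  suc-% t = trans (%-congˡ (cong suc (m≡m%n+[m/n]*n t n))) ([m+kn]%n≡m%n (suc (t % n)) (t / n) n)

  complement-+-% : ∀ r t → ((n ∸ r % n) + (r + t)) % n ≡ t % n
  complement-+-% r t = begin
    ((n ∸ r % n) + (r + t)) % n                   ≡⟨ %-congˡ rearranged ⟩
    (t + suc (r / n) * n) % n                     ≡⟨ [m+kn]%n≡m%n t (suc (r / n)) n ⟩
    t % n                                         ∎
    where
    open ≡-Reasoning
    rearranged : (n ∸ r % n) + (r + t) ≡ t + suc (r / n) * n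
    rearranged = begin
      (n ∸ r % n) + (r + t)                        ≡⟨ +-assoc (n ∸ r % n) r t ⟨
      (n ∸ r % n) + r + t                          ≡⟨ cong (λ x → (n ∸ r % n) + x + t) (m≡m%n+[m/n]*n r n) ⟩
      (n ∸ r % n) + (r % n + r / n * n) + t        ≡⟨ cong (_+ t) (+-assoc (n ∸ r % n) (r % n) _) ⟨
      (n ∸ r % n) + r % n + r / n * n + t          ≡⟨ cong (λ x → x + r / n * n + t) (m∸n+n≡m (<⇒≤ (m%n<n r n))) ⟩
      n + r / n * n + t                            ≡⟨ +-comm (suc (r / n) * n) t ⟩
      t + suc (r / n) * n                          ∎

  +-%-injective : ∀ r {i j} → i < n → j < n → (r + i) % n ≡ (r + j) % n → i ≡ j
  +-%-injective r {i} {j} i<n j<n eq = begin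
    i                                ≡⟨ m<n⇒m%n≡m i<n ⟨
    i % n                            ≡⟨ complement-+-% r i ⟨
    ((n ∸ r % n) + (r + i)) % n      ≡⟨ %-cong-+ˡ (n ∸ r % n) eq ⟩
    ((n ∸ r % n) + (r + j)) % n      ≡⟨ complement-+-% r j ⟩
    j % n                            ≡⟨ m<n⇒m%n≡m j<n ⟩
    j                                ∎
    where open ≡-Reasoning

module _ (G : Graph) .{{_ : NonZero (Graph.n G)}} where
  open Graph G using (n)

  Consecutive : (ℕ → Fin n) → Fin n → Fin n → Set
  Consecutive s x y = ∃ λ t → x ≡ s t × y ≡ s (suc t)

  CycAdj : (Fin n → Fin n) → Fin n → Fin n → Set
  CycAdj σ x y = CycConsec G σ x y ⊎ CycConsec G σ y x

  unroll : (Fin n → Fin n) → ℕ → Fin n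
  unroll σ t = σ (t mod n)

  toℕ-mod : ∀ t → toℕ (t mod n) ≡ t % n
  toℕ-mod t = toℕ-fromℕ< (m%n<n t n)

  unroll-cong : ∀ σ {t s} → t % n ≡ s % n → unroll σ t ≡ unroll σ s
  unroll-cong σ eq = cong σ (toℕ-injective (trans (toℕ-mod _) (trans eq (sym (toℕ-mod _)))))

  unroll-toℕ : ∀ σ i → unroll σ (toℕ i) ≡ σ i
  unroll-toℕ σ i = cong σ (toℕ-injective (trans (toℕ-mod _) (m<n⇒m%n≡m (toℕ<n i))))

  unroll-injective : ∀ {σ} → Injective _≡_ _≡_ σ → ∀ {t s} → unroll σ t ≡ unroll σ s → t % n ≡ s % n
  unroll-injective σ-inj {t} {s} eq = trans (sym (toℕ-mod t)) (trans (cong toℕ (σ-inj eq)) (toℕ-mod s))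

  CycConsec⇒Consecutive : ∀ σ {x y} → CycConsec G σ x y → Consecutive (unroll σ) x y
  CycConsec⇒Consecutive σ (i , j , x≡σi , y≡σj , step) =
    toℕ i , trans x≡σi (sym (unroll-toℕ σ i)) , trans y≡σj (sym (wrap step))
    where
    wrap : suc (toℕ i) ≡ toℕ j ⊎ (suc (toℕ i) ≡ n × toℕ j ≡ 0) → unroll σ (suc (toℕ i)) ≡ σ j
    wrap (inj₁ i+1≡j)       = trans (cong (unroll σ) i+1≡j) (unroll-toℕ σ j)
    wrap (inj₂ (i+1≡n , j≡0)) = trans (unroll-cong σ (trans (%-congˡ i+1≡n) (trans (n%n≡0 n) (sym j%n≡0))))
                                     (unroll-toℕ σ j)
      where
      j%n≡0 : toℕ j % n ≡ 0
      j%n≡0 = trans (m<n⇒m%n≡m (toℕ<n j)) j≡0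

  Consecutive⇒CycConsec : ∀ σ {x y} → Consecutive (unroll σ) x y → CycConsec G σ x y
  Consecutive⇒CycConsec σ (t , x≡ , y≡) = t mod n , suc t mod n , x≡ , y≡ , step (m≤n⇒m<n∨m≡n (m%n<n t n))
    where
    step : suc (t % n) < n ⊎ suc (t % n) ≡ n →
           suc (toℕ (t mod n)) ≡ toℕ (suc t mod n) ⊎ (suc (toℕ (t mod n)) ≡ n × toℕ (suc t mod n) ≡ 0)
    step (inj₁ t+1<n) = inj₁ (trans (cong suc (toℕ-mod t))
                                    (sym (trans (toℕ-mod (suc t)) (trans (suc-% {n} t) (m<n⇒m%n≡m t+1<n)))))
    step (inj₂ t+1≡n) = inj₂ (trans (cong suc (toℕ-mod t)) t+1≡n ,
                              trans (toℕ-mod (suc t)) (trans (suc-% {n} t) (trans (%-congˡ t+1≡n) (n%n≡0 n))))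

  rotate : ℕ → (Fin n → Fin n) → Fin n → Fin n
  rotate r σ i = unroll σ (r + toℕ i)

  unroll-rotate : ∀ r σ t → unroll (rotate r σ) t ≡ unroll σ (r + t)
  unroll-rotate r σ t = unroll-cong σ (%-cong-+ˡ r (trans (cong (_% n) (toℕ-mod t)) (m%n%n≡m%n t n)))

  Consecutive-rotate : ∀ r σ {x y} → Consecutive (unroll (rotate r σ)) x y ⇔ Consecutive (unroll σ) x y
  Consecutive-rotate r σ = mk⇔
    (λ { (t , x≡ , y≡) → r + t , trans x≡ (unroll-rotate r σ t) ,
                                 trans y≡ (trans (unroll-rotate r σ (suc t)) (cong (unroll σ) (+-suc r t))) })
    (λ { (t , x≡ , y≡) → (n ∸ r % n) + t , trans x≡ (back t) ,
                                 trans y≡ (trans (back (suc t)) (cong (unroll (rotate r σ)) (+-suc (n ∸ r % n) t))) })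
    where
    back : ∀ t → unroll σ t ≡ unroll (rotate r σ) ((n ∸ r % n) + t)
    back t = sym (trans (unroll-rotate r σ _)
                        (unroll-cong σ (trans (cong (_% n) (x∙yz≈y∙xz r (n ∸ r % n) t)) (complement-+-% r t))))

  CycConsec-rotate : ∀ r σ {x y} → CycConsec G (rotate r σ) x y ⇔ CycConsec G σ x y
  CycConsec-rotate r σ = mk⇔
    (Consecutive⇒CycConsec σ ∘ Equivalence.to (Consecutive-rotate r σ) ∘ CycConsec⇒Consecutive (rotate r σ))
    (Consecutive⇒CycConsec (rotate r σ) ∘ Equivalence.from (Consecutive-rotate r σ) ∘ CycConsec⇒Consecutive σ)

  CycConsec-≗ : ∀ {σ τ} → (∀ i → σ i ≡ τ i) → ∀ {x y} → CycConsec G σ x y → CycConsec G τ x y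
  CycConsec-≗ σ≗τ (i , j , x≡ , y≡ , step) = i , j , trans x≡ (σ≗τ i) , trans y≡ (σ≗τ j) , step

  CycConsec-reflect : ∀ σ {x y} → CycConsec G (σ ∘ opposite) x y → CycConsec G σ y x
  CycConsec-reflect σ (i , j , x≡ , y≡ , inj₁ i+1≡j) = opposite j , opposite i , y≡ , x≡ , inj₁ (begin
    suc (toℕ (opposite j))    ≡⟨ cong suc (opposite-prop j) ⟩
    suc (n ∸ suc (toℕ j))     ≡⟨ +-∸-assoc 1 (toℕ<n j) ⟨
    n ∸ toℕ j                 ≡⟨ cong (n ∸_) i+1≡j ⟨
    n ∸ suc (toℕ i)           ≡⟨ opposite-prop i ⟨
    toℕ (opposite i)          ∎)
    where open ≡-Reasoning
  CycConsec-reflect σ (i , j , x≡ , y≡ , inj₂ (i+1≡n , j≡0)) = opposite j , opposite i , y≡ , x≡ , inj₂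
    (trans (cong suc (opposite-prop j)) (trans (sym (+-∸-assoc 1 (toℕ<n j))) (cong (n ∸_) j≡0)) ,
     trans (opposite-prop i) (trans (cong (n ∸_) i+1≡n) (n∸n≡0 n)))

  CycConsec-unreflect : ∀ σ {x y} → CycConsec G σ y x → CycConsec G (σ ∘ opposite) x y
  CycConsec-unreflect σ = CycConsec-reflect (σ ∘ opposite) ∘ CycConsec-≗ (λ i → cong σ (sym (opposite-involutive i)))

  CycAdj-reflect : ∀ σ {x y} → CycAdj (σ ∘ opposite) x y ⇔ CycAdj σ x y
  CycAdj-reflect σ = mk⇔
    (λ { (inj₁ c) → inj₂ (CycConsec-reflect σ c) ; (inj₂ c) → inj₁ (CycConsec-reflect σ c) })
    (λ { (inj₁ c) → inj₂ (CycConsec-unreflect σ c) ; (inj₂ c) → inj₁ (CycConsec-unreflect σ c) })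

  CycConsec? : ∀ σ x y → Dec (CycConsec G σ x y)
  CycConsec? σ x y = any? λ i → any? λ j →
    (x ≟ᶠ σ i) ×-dec (y ≟ᶠ σ j) ×-dec
    ((suc (toℕ i) ≟ toℕ j) ⊎-dec ((suc (toℕ i) ≟ n) ×-dec (toℕ j ≟ 0)))

  CycAdj? : ∀ σ x y → Dec (CycAdj σ x y)
  CycAdj? σ x y = CycConsec? σ x y ⊎-dec CycConsec? σ y x

  CycAdj-rotate : ∀ r σ {x y} → CycAdj (rotate r σ) x y ⇔ CycAdj σ x y
  CycAdj-rotate r σ = mk⇔ (Sum.map (Equivalence.to (CycConsec-rotate r σ)) (Equivalence.to (CycConsec-rotate r σ)))
                          (Sum.map (Equivalence.from (CycConsec-rotate r σ)) (Equivalence.from (CycConsec-rotate r σ)))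

  CycAdj-≗ : ∀ {σ τ} → (∀ i → σ i ≡ τ i) → ∀ {x y} → CycAdj σ x y → CycAdj τ x y
  CycAdj-≗ σ≗τ = Sum.map (CycConsec-≗ σ≗τ) (CycConsec-≗ σ≗τ)

  HamCycle-orient : ∀ {M u a} → HamCycle G M → InE G M u a →
                    Σ (HamCycle G M) λ hc → CycConsec G (proj₁ (proj₂ hc)) a u
  HamCycle-orient hc@(3≤n , σ , σ-inj , M⇔ , M⊆E) ua∈M with Equivalence.to (M⇔ _ _) ua∈M
  ... | inj₂ a→u = hc , a→u
  ... | inj₁ u→a = (3≤n , σ ∘ opposite , σ∘opposite-injective ,
                    (λ x y → ⇔-trans (M⇔ x y) (⇔-sym (CycAdj-reflect σ))) , M⊆E) ,
                   CycConsec-unreflect σ u→a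
    where
    σ∘opposite-injective : Injective _≡_ _≡_ (σ ∘ opposite)
    σ∘opposite-injective {i} {j} eq =
      trans (sym (opposite-involutive i)) (trans (cong opposite (σ-inj eq)) (opposite-involutive j))

-- Hamilton paths and Pósa rotations

module _ (G : Graph) where
  open Graph G using (n; adj) renaming (sym to adj-sym; irrefl to adj-irrefl)

  E? : ∀ x y → Dec (E G x y)
  E? x y = adj x y Boolₚ.≟ true

  E-sym : ∀ {x y} → E G x y → E G y x
  E-sym {x} {y} xy∈E = trans (adj-sym y x) xy∈E

  E-irrefl : ∀ {x} → ¬ E G x x
  E-irrefl {x} xx∈E = contradiction (trans (sym (adj-irrefl x)) xx∈E) λ ()

  record IsHamPath (f : ℕ → Fin n) : Set where
    field
      injective : ∀ {i j} → i < n → j < n → f i ≡ f j → i ≡ j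
      adjacent  : ∀ {i} → suc i < n → E G (f i) (f (suc i))

  IsHamPath? : ∀ f → Dec (IsHamPath f)
  IsHamPath? f = map′ from-pair to-pair
    (∀<? (λ i → ∀<? (λ j → (f i ≟ᶠ f j) →-dec (i ≟ j)) n) n ×-dec
     ∀<? (λ i → (suc i <? n) →-dec E? (f i) (f (suc i))) n)
    where
    Pair : Set
    Pair = (∀ {i} → i < n → ∀ {j} → j < n → f i ≡ f j → i ≡ j) ×
           (∀ {i} → i < n → suc i < n → E G (f i) (f (suc i)))
    from-pair : Pair → IsHamPath f
    from-pair (inj , adj) = record
      { injective = λ i<n j<n → inj i<n j<n
      ; adjacent  = λ i+1<n → adj (<-trans (n<1+n _) i+1<n) i+1<n
      }
    to-pair : IsHamPath f → Pair
    to-pair hp = (λ i<n j<n → IsHamPath.injective hp i<n j<n) , (λ _ → IsHamPath.adjacent hp)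

  IsHamPath-cong : ∀ {f g} → (∀ {t} → t < n → f t ≡ g t) → IsHamPath f → IsHamPath g
  IsHamPath-cong f≗g hp = record
    { injective = λ i<n j<n gi≡gj → injective i<n j<n (trans (f≗g i<n) (trans gi≡gj (sym (f≗g j<n))))
    ; adjacent  = λ i+1<n → subst₂ (E G) (f≗g (<-trans (n<1+n _) i+1<n)) (f≗g i+1<n) (adjacent i+1<n)
    }
    where open IsHamPath hp

  module _ {f : ℕ → Fin n} (hp : IsHamPath f) where
    open IsHamPath hp

    positions-injective : Injective _≡_ _≡_ (λ (i : Fin n) → f (toℕ i))
    positions-injective eq = toℕ-injective (injective (toℕ<n _) (toℕ<n _) eq)

    ∑-positions : ∀ {m} → n ≡ suc m → (h : Fin n → ℕ) → ∑[ i < suc m ] h (f (toℕ i)) ≡ ∑[ v < n ] h v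
    ∑-positions n≡1+m h = trans (sym (∑-cong-bound (h ∘ f) n≡1+m)) (sym (∑-reindex positions-injective h))

  Step : (ℕ → Fin n) → Fin n → Fin n → Set
  Step f x y = ∃ λ i → suc i < n × f i ≡ x × f (suc i) ≡ y

  deg≡∑E : ∀ z → deg G z ≡ ∑[ v < n ] 𝟙 (E? v z)
  deg≡∑E z = trans (sumˡ-allFin n _) (sum-cong-≗ indicator)
    where
    indicator : ∀ v → (if adj z v then 1 else 0) ≡ 𝟙 (E? v z)
    indicator v rewrite adj-sym z v with adj v z
    ... | true  = refl
    ... | false = refl

  module _ {n₃ : ℕ} (n≡3+n₃ : n ≡ 3 + n₃) {f : ℕ → Fin n} (hp : IsHamPath f) where
    open IsHamPath hp

    deg-last : deg G (f (2 + n₃)) ≡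
               𝟙 (E? (f 0) (f (2 + n₃))) + ∑[ i < n₃ ] 𝟙 (E? (f (suc (toℕ i))) (f (2 + n₃))) + 1
    deg-last = begin
      deg G z                                                ≡⟨ deg≡∑E z ⟩
      ∑[ v < n ] 𝟙 (E? v z)                                  ≡⟨ ∑-positions hp n≡3+n₃ (λ v → 𝟙 (E? v z)) ⟨
      g 0 + ∑[ i < 2 + n₃ ] g (suc (toℕ i))                  ≡⟨ cong (g 0 +_) (∑-last (1 + n₃) (g ∘ suc)) ⟩
      g 0 + (∑[ i < 1 + n₃ ] g (suc (toℕ i)) + g (2 + n₃))   ≡⟨ cong (λ x → g 0 + (x + g (2 + n₃))) (∑-last n₃ (g ∘ suc)) ⟩
      g 0 + (∑[ i < n₃ ] g (suc (toℕ i)) + g (1 + n₃) + g (2 + n₃))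
                  ≡⟨ cong₂ (λ x y → g 0 + (∑[ i < n₃ ] g (suc (toℕ i)) + x + y))
                           (𝟙-yes (E? _ z) (adjacent (≤-reflexive (sym n≡3+n₃)))) (𝟙-no (E? z z) E-irrefl) ⟩
      g 0 + (∑[ i < n₃ ] g (suc (toℕ i)) + 1 + 0)            ≡⟨ cong (g 0 +_) (+-identityʳ _) ⟩
      g 0 + (∑[ i < n₃ ] g (suc (toℕ i)) + 1)                ≡⟨ +-assoc (g 0) _ 1 ⟨
      g 0 + ∑[ i < n₃ ] g (suc (toℕ i)) + 1                  ∎
      where
      open ≡-Reasoning
      z : Fin n
      z = f (2 + n₃)
      g : ℕ → ℕ
      g i = 𝟙 (E? (f i) z)

  -- f ∘ pivot p is the Pósa rotation f₀, …, f_p, f₍ₙ₋₁₎, f₍ₙ₋₂₎, …, f₍ₚ₊₁₎ of f at position p.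
  pivot : ℕ → ℕ → ℕ
  pivot p t with t ≤? p
  ... | yes _ = t
  ... | no  _ = n + p ∸ t

  pivot-≤ : ∀ {p t} → t ≤ p → pivot p t ≡ t
  pivot-≤ {p} {t} t≤p with t ≤? p
  ... | yes _   = refl
  ... | no  t≰p = contradiction t≤p t≰p

  pivot-> : ∀ {p t} → p < t → pivot p t ≡ n + p ∸ t
  pivot-> {p} {t} p<t with t ≤? p
  ... | yes t≤p = contradiction t≤p (<⇒≱ p<t)
  ... | no  _   = refl

  reflected-bounds : ∀ {p t} → p < t → t < n → n + p ∸ t < n × p < n + p ∸ t
  reflected-bounds {p} {t} p<t t<n =
    +-cancelʳ-< t _ _ (subst (_< n + t) (sym n+p∸t+t) (+-monoʳ-< n p<t)) ,
    +-cancelʳ-< t _ _ (subst (p + t <_) (sym n+p∸t+t) (subst (p + t <_) (+-comm p n) (+-monoʳ-< p t<n)))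
    where
    n+p∸t+t : n + p ∸ t + t ≡ n + p
    n+p∸t+t = m∸n+n≡m (≤-trans (<⇒≤ t<n) (m≤m+n n p))

  pivot-< : ∀ p {t} → t < n → pivot p t < n
  pivot-< p {t} t<n with t ≤? p
  ... | yes _   = t<n
  ... | no  t≰p = proj₁ (reflected-bounds (≰⇒> t≰p) t<n)

  pivot-involutive : ∀ p {t} → t < n → pivot p (pivot p t) ≡ t
  pivot-involutive p {t} t<n with t ≤? p
  ... | yes t≤p = pivot-≤ t≤p
  ... | no  t≰p = trans (pivot-> (proj₂ (reflected-bounds (≰⇒> t≰p) t<n)))
                        (m∸[m∸n]≡n (≤-trans (<⇒≤ t<n) (m≤m+n n p)))

  pivot-last : ∀ {p N} → n ≡ suc N → p < N → pivot p N ≡ suc p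
  pivot-last {p} {N} n≡1+N p<N = trans (pivot-> p<N) (trans (cong (λ m → m + p ∸ N) n≡1+N)
                                   (trans (cong (_∸ N) (sym (+-suc N p))) (m+n∸m≡n N (suc p))))

  pivot-reflected-suc : ∀ {p t} → p < t → suc t < n → pivot p t ≡ suc (pivot p (suc t))
  pivot-reflected-suc {p} {t} p<t t+1<n = begin
    pivot p t               ≡⟨ pivot-> p<t ⟩
    n + p ∸ t               ≡⟨ +-∸-assoc 1 (≤-trans (<⇒≤ t+1<n) (m≤m+n n p)) ⟩
    suc (n + p ∸ suc t)     ≡⟨ cong suc (pivot-> (<-trans p<t (n<1+n t))) ⟨
    suc (pivot p (suc t))   ∎
    where open ≡-Reasoning

  pivot-isHamPath : ∀ {f p N} → IsHamPath f → n ≡ suc N → p < N → E G (f p) (f N) → IsHamPath (f ∘ pivot p)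
  pivot-isHamPath {f} {p} {N} hp n≡1+N p<N fp-fN∈E = record
    { injective = λ {i} {j} i<n j<n eq → trans (sym (pivot-involutive p i<n))
        (trans (cong (pivot p) (injective (pivot-< p i<n) (pivot-< p j<n) eq)) (pivot-involutive p j<n))
    ; adjacent = adjacent′
    }
    where
    open IsHamPath hp
    adjacent′ : ∀ {t} → suc t < n → E G (f (pivot p t)) (f (pivot p (suc t)))
    adjacent′ {t} t+1<n = by-position (suc t ≤? p) (t ≤? p)
      where
      by-position : Dec (suc t ≤ p) → Dec (t ≤ p) → E G (f (pivot p t)) (f (pivot p (suc t)))
      by-position (yes t+1≤p) _ = subst₂ (λ x y → E G (f x) (f y))
        (sym (pivot-≤ (<⇒≤ t+1≤p))) (sym (pivot-≤ t+1≤p)) (adjacent t+1<n)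
      by-position (no t+1≰p) (yes t≤p) = subst₂ (λ x y → E G (f x) (f y))
        (sym (trans (pivot-≤ t≤p) t≡p)) (sym (trans (cong (pivot p ∘ suc) t≡p) pivot-after-p)) fp-fN∈E
        where
        t≡p : t ≡ p
        t≡p = ≤-antisym t≤p (s≤s⁻¹ (≰⇒> t+1≰p))
        pivot-after-p : pivot p (suc p) ≡ N
        pivot-after-p = trans (cong (pivot p) (sym (pivot-last n≡1+N p<N)))
                              (pivot-involutive p (subst (N <_) (sym n≡1+N) (n<1+n N)))
      by-position (no _) (no t≰p) = subst (λ x → E G (f x) (f (pivot p (suc t)))) (sym reflected)
        (E-sym (adjacent (subst (_< n) reflected (pivot-< p (<-trans (n<1+n t) t+1<n)))))
        where
        reflected : pivot p t ≡ suc (pivot p (suc t))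
        reflected = pivot-reflected-suc (≰⇒> t≰p) t+1<n

-- Hamilton cycles

module FromHamCycle {G : Graph} {M : EdgeSet G} .{{_ : NonZero (Graph.n G)}} (hc : HamCycle G M) where
  open Graph G using (n)

  σ : Fin n → Fin n
  σ = proj₁ (proj₂ hc)

  σ-injective : Injective _≡_ _≡_ σ
  σ-injective = proj₁ (proj₂ (proj₂ hc))

  M⇔CycAdj : ∀ x y → InE G M x y ⇔ CycAdj G σ x y
  M⇔CycAdj = proj₁ (proj₂ (proj₂ (proj₂ hc)))

  M⊆E : ∀ {x y} → InE G M x y → E G x y
  M⊆E = proj₂ (proj₂ (proj₂ (proj₂ hc))) _ _

  InE-sym : ∀ {x y} → InE G M x y → InE G M y x
  InE-sym {x} {y} = Equivalence.from (M⇔CycAdj y x) ∘ swap ∘ Equivalence.to (M⇔CycAdj x y)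

  path-from : ℕ → ℕ → Fin n
  path-from r t = unroll G σ (r + t)

  Step⇒InE : ∀ r {x y} → Step G (path-from r) x y → InE G M x y
  Step⇒InE r (i , _ , x≡ , y≡) = Equivalence.from (M⇔CycAdj _ _)
    (inj₁ (Consecutive⇒CycConsec G σ (r + i , sym x≡ , trans (sym y≡) (cong (unroll G σ) (+-suc r i)))))

  path-from-isHamPath : ∀ r → IsHamPath G (path-from r)
  path-from-isHamPath r = record
    { injective = λ i<n j<n eq → +-%-injective r i<n j<n (unroll-injective G σ-injective eq)
    ; adjacent  = λ i+1<n → M⊆E (Step⇒InE r (_ , i+1<n , refl , refl))
    }

  path-through : ∀ v → ∃ λ r → path-from r 0 ≡ v
  path-through v with injective⇒surjective σ-injective v
  ... | i , σi≡v = toℕ i , trans (cong (unroll G σ) (+-identityʳ (toℕ i))) (trans (unroll-toℕ G σ i) σi≡v)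

module HamCyclesThrough (G : Graph) {n₃ : ℕ} (n≡3+n₃ : Graph.n G ≡ 3 + n₃) (a u : Fin (Graph.n G)) where
  open Graph G using (n)

  instance
    n≢0 : NonZero n
    n≢0 = subst NonZero (sym n≡3+n₃) _

  HamPathFrom : (ℕ → Fin n) → Set
  HamPathFrom f = IsHamPath G f × f 0 ≡ a × f 1 ≡ u

  HamPathFrom? : ∀ f → Dec (HamPathFrom f)
  HamPathFrom? f = IsHamPath? G f ×-dec (f 0 ≟ᶠ a) ×-dec (f 1 ≟ᶠ u)

  at : Vec (Fin n) n → ℕ → Fin n
  at = lookupℕ a

  Closing : Vec (Fin n) n → Set
  Closing w = E G a (at w (2 + n₃))

  -- The positions suc i, for i < n₃, are those other than the start, the end and its predecessor.
  Rotatable : Vec (Fin n) n → Fin n₃ → Set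
  Rotatable w i = E G (at w (suc (toℕ i))) (at w (2 + n₃))

  Closing? : ∀ w → Dec (Closing w)
  Closing? w = E? G a (at w (2 + n₃))

  Rotatable? : ∀ w i → Dec (Rotatable w i)
  Rotatable? w i = E? G (at w (suc (toℕ i))) (at w (2 + n₃))

  N<n : 2 + n₃ < n
  N<n = ≤-reflexive (sym n≡3+n₃)

  0<n : 0 < n
  0<n = subst (0 <_) (sym n≡3+n₃) (s≤s z≤n)

  1<n : 1 < n
  1<n = subst (1 <_) (sym n≡3+n₃) (s≤s (s≤s z≤n))

  rotations : Vec (Fin n) n → ℕ
  rotations w = ∑[ i < n₃ ] 𝟙 (Rotatable? w i)

  end-parity : (∀ {f} → HamPathFrom f → Odd (deg G (f (2 + n₃)))) →
               ∀ {w} → HamPathFrom (at w) → Even (𝟙 (Closing? w) + rotations w)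
  end-parity odd-end {w} valid@(hp , start , _) = odd-suc⇒even (subst Odd degree (odd-end valid))
    where
    z : Fin n
    z = at w (2 + n₃)
    closing-cong : 𝟙 (E? G (at w 0) z) ≡ 𝟙 (E? G a z)
    closing-cong = 𝟙-cong (subst (λ v → E G v z) start) (subst (λ v → E G v z) (sym start)) (E? G _ z) (E? G a z)
    degree : deg G z ≡ suc (𝟙 (E? G a z) + rotations w)
    degree = trans (deg-last G n≡3+n₃ hp)
                   (trans (cong (λ x → x + rotations w + 1) closing-cong) (+-comm _ 1))

  rotate-at : ℕ → Vec (Fin n) n → Vec (Fin n) n
  rotate-at p w = tabulate (λ i → at w (pivot G p (toℕ i)))

  at-rotate-at : ∀ p w {t} → t < n → at (rotate-at p w) t ≡ at w (pivot G p t)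
  at-rotate-at p w t<n = trans (lookupℕ-tabulate a _ t<n) (cong (at w ∘ pivot G p) (toℕ-fromℕ< t<n))

  rotate-at-involutive : ∀ p w → rotate-at p (rotate-at p w) ≡ w
  rotate-at-involutive p w = Vec-ext λ i → begin
    lookup (rotate-at p (rotate-at p w)) i        ≡⟨ Vecₚ.lookup∘tabulate _ i ⟩
    at (rotate-at p w) (pivot G p (toℕ i))        ≡⟨ at-rotate-at p w (pivot-< G p (toℕ<n i)) ⟩
    at w (pivot G p (pivot G p (toℕ i)))          ≡⟨ cong (at w) (pivot-involutive G p (toℕ<n i)) ⟩
    at w (toℕ i)                                  ≡⟨ lookupℕ-toℕ a w i ⟩
    lookup w i                                    ∎
    where open ≡-Reasoning

  module Rotation (w : Vec (Fin n) n) (valid : HamPathFrom (at w)) (i : Fin n₃) (rotatable : Rotatable w i) where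
    open IsHamPath (proj₁ valid)

    p : ℕ
    p = suc (toℕ i)

    p+1<N : suc p < 2 + n₃
    p+1<N = s≤s (s≤s (toℕ<n i))

    rotated-valid : HamPathFrom (at (rotate-at p w))
    rotated-valid =
      IsHamPath-cong G (λ t<n → sym (at-rotate-at p w t<n))
        (pivot-isHamPath G (proj₁ valid) n≡3+n₃ (<-trans (n<1+n p) p+1<N) rotatable) ,
      trans (at-rotate-at p w 0<n) (trans (cong (at w) (pivot-≤ G {p} z≤n)) (proj₁ (proj₂ valid))) ,
      trans (at-rotate-at p w 1<n) (trans (cong (at w) (pivot-≤ G {p} (s≤s z≤n))) (proj₂ (proj₂ valid)))

    at-rotated-end : at (rotate-at p w) (2 + n₃) ≡ at w (suc p)
    at-rotated-end = trans (at-rotate-at p w N<n) (cong (at w) (pivot-last G n≡3+n₃ (<-trans (n<1+n p) p+1<N)))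

    rotated-rotatable : Rotatable (rotate-at p w) i
    rotated-rotatable = subst₂ (E G)
      (sym (trans (at-rotate-at p w (<-trans (n<1+n p) (<-trans p+1<N N<n))) (cong (at w) (pivot-≤ G {p} ≤-refl))))
      (sym at-rotated-end)
      (adjacent (<-trans p+1<N N<n))

    rotated-≢ : rotate-at p w ≢ w
    rotated-≢ eq = <-irrefl (injective (<-trans p+1<N N<n) N<n
                                       (trans (sym at-rotated-end) (cong (λ v → at v (2 + n₃)) eq)))
                            p+1<N

  cycleEdges : Vec (Fin n) n → EdgeSet G
  cycleEdges w = tabulate λ x → tabulate λ y → does (CycAdj? G (lookup w) x y)

  InE-cycleEdges : ∀ w x y → InE G (cycleEdges w) x y ⇔ CycAdj G (lookup w) x y
  InE-cycleEdges w x y = ⇔-trans (mk⇔ (trans (sym entry)) (trans entry)) (does⇔ (CycAdj? G (lookup w) x y))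
    where
    entry : lookup (lookup (cycleEdges w) x) y ≡ does (CycAdj? G (lookup w) x y)
    entry = trans (cong (λ row → lookup row y) (Vecₚ.lookup∘tabulate _ x)) (Vecₚ.lookup∘tabulate _ y)

  EdgeSet-ext : ∀ {M M′ : EdgeSet G} → (∀ x y → InE G M x y ⇔ InE G M′ x y) → M ≡ M′
  EdgeSet-ext M⇔M′ = Vec-ext λ x → Vec-ext λ y → ≡true-ext (M⇔M′ x y)

  module ClosedPath (w : Vec (Fin n) n) (valid : HamPathFrom (at w)) (closing : Closing w) where
    open IsHamPath (proj₁ valid)

    at-toℕ : ∀ i → at w (toℕ i) ≡ lookup w i
    at-toℕ = lookupℕ-toℕ a w

    lookup-injective : Injective _≡_ _≡_ (lookup w)
    lookup-injective {i} {j} eq =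
      toℕ-injective (injective (toℕ<n i) (toℕ<n j) (trans (at-toℕ i) (trans eq (sym (at-toℕ j)))))

    CycConsec⇒E : ∀ {x y} → CycConsec G (lookup w) x y → E G x y
    CycConsec⇒E (i , j , x≡ , y≡ , inj₁ i+1≡j) =
      subst₂ (E G) (sym (trans x≡ (sym (at-toℕ i)))) (sym (trans y≡ (trans (sym (at-toℕ j)) (cong (at w) (sym i+1≡j)))))
             (adjacent (subst (_< n) (sym i+1≡j) (toℕ<n j)))
    CycConsec⇒E (i , j , x≡ , y≡ , inj₂ (i+1≡n , j≡0)) =
      subst₂ (E G) (sym (trans x≡ (trans (sym (at-toℕ i)) (cong (at w) i≡N))))
                   (sym (trans y≡ (trans (sym (at-toℕ j)) (trans (cong (at w) j≡0) (proj₁ (proj₂ valid))))))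
             (E-sym G closing)
      where
      i≡N : toℕ i ≡ 2 + n₃
      i≡N = suc-injective (trans i+1≡n n≡3+n₃)

    isHamCycle : HamCycle G (cycleEdges w)
    isHamCycle = subst (3 ≤_) (sym n≡3+n₃) (s≤s (s≤s (s≤s z≤n))) , lookup w , lookup-injective , InE-cycleEdges w ,
                 λ x y xy∈ → [ CycConsec⇒E , E-sym G ∘ CycConsec⇒E ] (Equivalence.to (InE-cycleEdges w x y) xy∈)

    position : ∀ {t} → t < n → Fin n
    position t<n = fromℕ< t<n

    at-position : ∀ {t} (t<n : t < n) → lookup w (position t<n) ≡ at w t
    at-position t<n = trans (sym (at-toℕ _)) (cong (at w) (toℕ-fromℕ< t<n))

    consecutive : ∀ {s} → suc s < n → CycConsec G (lookup w) (at w s) (at w (suc s))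
    consecutive {s} s+1<n = position s<n , position s+1<n ,
      sym (at-position s<n) , sym (at-position s+1<n) ,
      inj₁ (trans (cong suc (toℕ-fromℕ< s<n)) (sym (toℕ-fromℕ< s+1<n)))
      where
      s<n : s < n
      s<n = <-trans (n<1+n s) s+1<n

    ua∈cycleEdges : InE G (cycleEdges w) u a
    ua∈cycleEdges = Equivalence.from (InE-cycleEdges w u a)
      (inj₂ (subst₂ (CycConsec G (lookup w)) (proj₁ (proj₂ valid)) (proj₂ (proj₂ valid)) (consecutive 1<n)))

    interior-neighbours : ∀ {s y} → suc (suc s) < n → CycAdj G (lookup w) (at w (suc s)) y →
                          y ≡ at w s ⊎ y ≡ at w (suc (suc s))
    interior-neighbours {s} s+2<n (inj₁ (i , j , x≡ , y≡ , step)) = inj₂ (after step)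
      where
      s+1≡i : suc s ≡ toℕ i
      s+1≡i = injective (<-trans (n<1+n _) s+2<n) (toℕ<n i) (trans x≡ (sym (at-toℕ i)))
      after : suc (toℕ i) ≡ toℕ j ⊎ (suc (toℕ i) ≡ n × toℕ j ≡ 0) → _
      after (inj₁ i+1≡j)        = trans y≡ (trans (sym (at-toℕ j)) (cong (at w) (sym (trans (cong suc s+1≡i) i+1≡j))))
      after (inj₂ (i+1≡n , _))  = contradiction (trans (cong suc s+1≡i) i+1≡n) (<⇒≢ s+2<n)
    interior-neighbours {s} s+2<n (inj₂ (i , j , y≡ , x≡ , step)) = inj₁ (before step)
      where
      s+1≡j : suc s ≡ toℕ j
      s+1≡j = injective (<-trans (n<1+n _) s+2<n) (toℕ<n j) (trans x≡ (sym (at-toℕ j)))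
      before : suc (toℕ i) ≡ toℕ j ⊎ (suc (toℕ i) ≡ n × toℕ j ≡ 0) → _
      before (inj₁ i+1≡j)       =
        trans y≡ (trans (sym (at-toℕ i)) (cong (at w) (suc-injective (trans i+1≡j (sym s+1≡j)))))
      before (inj₂ (_ , j≡0))   = contradiction (trans s+1≡j j≡0) λ ()

  cycleEdges-injective : ∀ {w w′} → HamPathFrom (at w) → Closing w → HamPathFrom (at w′) → Closing w′ →
                   cycleEdges w ≡ cycleEdges w′ → w ≡ w′
  cycleEdges-injective {w} {w′} valid closing valid′ closing′ eq =
    Vec-ext λ i → trans (sym (lookupℕ-toℕ a w i)) (trans (same-at (toℕ<n i)) (lookupℕ-toℕ a w′ i))
    where
    open ClosedPath w valid closing using (interior-neighbours)
    open ClosedPath w′ valid′ closing′ using (consecutive)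
    open IsHamPath (proj₁ valid′) using () renaming (injective to injective′)
    transfer : ∀ {x y} → CycAdj G (lookup w′) x y → CycAdj G (lookup w) x y
    transfer {x} {y} = Equivalence.to (InE-cycleEdges w x y) ∘ subst (λ M → InE G M x y) (sym eq)
                     ∘ Equivalence.from (InE-cycleEdges w′ x y)
    same-at : ∀ {t} → t < n → at w t ≡ at w′ t
    same-at {zero}        _     = trans (proj₁ (proj₂ valid)) (sym (proj₁ (proj₂ valid′)))
    same-at {suc zero}    _     = trans (proj₂ (proj₂ valid)) (sym (proj₂ (proj₂ valid′)))
    same-at {suc (suc s)} s+2<n with interior-neighbours s+2<n
                                       (subst (λ v → CycAdj G (lookup w) v (at w′ (suc (suc s)))) (sym (same-at s+1<n))
                                              (transfer (inj₁ (consecutive s+2<n))))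
      where
      s+1<n : suc s < n
      s+1<n = <-trans (n<1+n _) s+2<n
    ... | inj₁ w′s+2≡ws = contradiction (injective′ s+2<n (<-trans (n<1+n s) (<-trans (n<1+n _) s+2<n))
                                           (trans w′s+2≡ws (same-at (<-trans (n<1+n s) (<-trans (n<1+n _) s+2<n)))))
                                         (λ ())
    ... | inj₂ w′s+2≡ws+2 = sym w′s+2≡ws+2

  HamCycle⇒closed-path : ∀ {M} → HamCycle G M → InE G M u a →
                         ∃ λ w → (HamPathFrom (at w) × Closing w) × cycleEdges w ≡ M
  HamCycle⇒closed-path {M} hc ua∈M = w , (valid , closing) , EdgeSet-ext same-edges
    where
    oriented : Σ (HamCycle G M) λ hc′ → CycConsec G (proj₁ (proj₂ hc′)) a u
    oriented = HamCycle-orient G {M} hc ua∈M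
    open FromHamCycle {M = M} (proj₁ oriented)
    start : Consecutive G (unroll G σ) a u
    start = CycConsec⇒Consecutive G σ (proj₂ oriented)
    t : ℕ
    t = proj₁ start
    w : Vec (Fin n) n
    w = tabulate (path-from t ∘ toℕ)
    at-w : ∀ {s} → s < n → at w s ≡ path-from t s
    at-w s<n = trans (lookupℕ-tabulate a _ s<n) (cong (path-from t) (toℕ-fromℕ< s<n))
    valid : HamPathFrom (at w)
    valid = IsHamPath-cong G (sym ∘ at-w) (path-from-isHamPath t) ,
            trans (at-w 0<n) (trans (cong (unroll G σ) (+-identityʳ t)) (sym (proj₁ (proj₂ start)))) ,
            trans (at-w 1<n) (trans (cong (unroll G σ) (+-comm t 1)) (sym (proj₂ (proj₂ start))))
    wraps : unroll G σ (suc (t + (2 + n₃))) ≡ a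
    wraps = trans (unroll-cong G σ (trans (cong (_% n) (trans (sym (+-suc t (2 + n₃))) (cong (t +_) (sym n≡3+n₃))))
                                           ([m+n]%n≡m%n t n)))
                  (sym (proj₁ (proj₂ start)))
    closing : Closing w
    closing = E-sym G (subst₂ (E G) (sym (at-w N<n)) wraps last-edge)
      where
      last-edge : E G (path-from t (2 + n₃)) (unroll G σ (suc (t + (2 + n₃))))
      last-edge = M⊆E (Equivalence.from (M⇔CycAdj _ _) (inj₁ (Consecutive⇒CycConsec G σ (t + (2 + n₃) , refl , refl))))
    same-edges : ∀ x y → InE G (cycleEdges w) x y ⇔ InE G M x y
    same-edges x y = ⇔-trans (InE-cycleEdges w x y)
      (⇔-trans (mk⇔ (CycAdj-≗ G (Vecₚ.lookup∘tabulate _)) (CycAdj-≗ G (sym ∘ Vecₚ.lookup∘tabulate _)))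
      (⇔-trans (CycAdj-rotate G t σ) (⇔-sym (M⇔CycAdj x y))))

  paths : List (Vec (Fin n) n)
  paths = filter (HamPathFrom? ∘ at) (allVecs (allFin n) n)

  closed-paths : List (Vec (Fin n) n)
  closed-paths = filter Closing? paths

  rotatable-paths : Fin n₃ → List (Vec (Fin n) n)
  rotatable-paths i = filter (λ w → Rotatable? w i) paths

  paths-unique : Unique paths
  paths-unique = filter⁺ (HamPathFrom? ∘ at) (allVecs-unique (allFin⁺ n) n)

  ∈-paths : ∀ {w} → HamPathFrom (at w) → w ∈ paths
  ∈-paths valid = ∈-filter⁺ (HamPathFrom? ∘ at) (∈-allVecs ∈-allFin _) valid

  ∈-paths⁻ : ∀ {w} → w ∈ paths → HamPathFrom (at w)
  ∈-paths⁻ w∈ = proj₂ (∈-filter⁻ (HamPathFrom? ∘ at) {xs = allVecs (allFin n) n} w∈)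

  ∈-closed-paths⁻ : ∀ {w} → w ∈ closed-paths → HamPathFrom (at w) × Closing w
  ∈-closed-paths⁻ w∈ with ∈-filter⁻ Closing? {xs = paths} w∈
  ... | w∈paths , closing = ∈-paths⁻ w∈paths , closing

  even-rotatable : ∀ i → Even (length (rotatable-paths i))
  even-rotatable i = involution⇒even-length (Vecₚ.≡-dec _≟ᶠ_) (rotate-at p) (rotate-at-involutive p)
                       (filter⁺ (λ w → Rotatable? w i) paths-unique) stays no-fixed
    where
    p : ℕ
    p = suc (toℕ i)
    stays : ∀ {w} → w ∈ rotatable-paths i → rotate-at p w ∈ rotatable-paths i
    stays {w} w∈ with ∈-filter⁻ (λ w → Rotatable? w i) {xs = paths} w∈
    ... | w∈paths , rotatable = ∈-filter⁺ (λ w → Rotatable? w i) (∈-paths rotated-valid) rotated-rotatable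
      where open Rotation w (∈-paths⁻ w∈paths) i rotatable
    no-fixed : ∀ {w} → w ∈ rotatable-paths i → rotate-at p w ≢ w
    no-fixed {w} w∈ with ∈-filter⁻ (λ w → Rotatable? w i) {xs = paths} w∈
    ... | w∈paths , rotatable = Rotation.rotated-≢ w (∈-paths⁻ w∈paths) i rotatable

  even-closed-paths : (∀ {f} → HamPathFrom f → Odd (deg G (f (2 + n₃)))) → Even (length closed-paths)
  even-closed-paths odd-end = subst Even (sym (length-filter Closing? paths)) (even-cancelʳ _ all-even rotations-even)
    where
    all-even : Even (sumˡ (map (λ w → 𝟙 (Closing? w)) paths) + sumˡ (map rotations paths))
    all-even = subst Even (sumˡ-map-+ paths (λ w → 𝟙 (Closing? w)) rotations)
                 (sumˡ-even paths (λ {w} w∈ → end-parity odd-end {w} (∈-paths⁻ {w} w∈)))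
    rotations-even : Even (sumˡ (map rotations paths))
    rotations-even = subst Even (sym (sumˡ-map-∑ paths (λ i w → 𝟙 (Rotatable? w i))))
                       (∑-even (λ i → subst Even (length-filter (λ w → Rotatable? w i) paths) (even-rotatable i)))

  even-HamCycles-through : (∀ {f} → HamPathFrom f → Odd (deg G (f (2 + n₃)))) → EvenlyManyHamCyclesThrough G u a
  even-HamCycles-through odd-end =
    map cycleEdges closed-paths ,
    map-unique cycleEdges cycleEdges-injective-on-closed (filter⁺ Closing? paths-unique) ,
    (λ M → mk⇔ listed⇒HamCycle (HamCycle⇒listed M)) ,
    subst Even (sym (Listₚ.length-map cycleEdges closed-paths)) (even-closed-paths odd-end)
    where
    cycleEdges-injective-on-closed : ∀ {w w′} → w ∈ closed-paths → w′ ∈ closed-paths →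
                                     cycleEdges w ≡ cycleEdges w′ → w ≡ w′
    cycleEdges-injective-on-closed w∈ w′∈ =
      cycleEdges-injective (proj₁ (∈-closed-paths⁻ w∈)) (proj₂ (∈-closed-paths⁻ w∈))
                           (proj₁ (∈-closed-paths⁻ w′∈)) (proj₂ (∈-closed-paths⁻ w′∈))
    listed⇒HamCycle : ∀ {M} → M ∈ map cycleEdges closed-paths → HamCycle G M × InE G M u a
    listed⇒HamCycle M∈ with ∈-map⁻ cycleEdges M∈
    ... | w , w∈ , refl = isHamCycle , ua∈cycleEdges
      where open ClosedPath w (proj₁ (∈-closed-paths⁻ w∈)) (proj₂ (∈-closed-paths⁻ w∈))
    HamCycle⇒listed : ∀ M → HamCycle G M × InE G M u a → M ∈ map cycleEdges closed-paths
    HamCycle⇒listed M (hc , ua∈M) = listed (HamCycle⇒closed-path hc ua∈M)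
      where
      listed : (∃ λ w → (HamPathFrom (at w) × Closing w) × cycleEdges w ≡ M) → M ∈ map cycleEdges closed-paths
      listed (w , (valid , closing) , edges≡M) =
        subst (_∈ map cycleEdges closed-paths) edges≡M
              (∈-map⁺ cycleEdges (∈-filter⁺ Closing? (∈-paths {w} valid) closing))

-- Graphs in which removing A leaves k paths

clamp : ∀ L → ℕ → Fin (suc L)
clamp L m = fromℕ< (s≤s (m⊓n≤n m L))

toℕ-clamp : ∀ {L m} → m ≤ L → toℕ (clamp L m) ≡ m
toℕ-clamp {L} {m} m≤L = trans (toℕ-fromℕ< (s≤s (m⊓n≤n m L))) (m≤n⇒m⊓n≡m m≤L)

fin⇒suc : ∀ {m} → Fin m → ∃ λ m′ → m ≡ suc m′
fin⇒suc {suc m′} _ = m′ , refl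

-- The count behind HamPathFromA for a Hamilton path f₀, …, f_m: aᵢ and aₛ count the vertices of A among
-- f₀, …, f₍ₘ₋₁₎ and f₁, …, f_m, F and B the path edges traversed forwards and backwards, and S the
-- n − 2k path edges.
tight-count : ∀ {m k aᵢ aₛ aₘ F F′ B S} →
              m ≤ aᵢ + aₛ + F + B → aᵢ + aₘ ≡ k → 1 + aₛ ≡ k → F ≤ F′ → F′ + B ≤ S → k + k + S ≡ suc m →
              aₘ ≡ 0 × S ≤ F′ + B
tight-count {m} {k} {aᵢ} {aₛ} {aₘ} {F} {F′} {B} {S} covered aᵢ+aₘ≡k 1+aₛ≡k F≤F′ F′+B≤S total =
  n≤0⇒n≡0 (+-cancelˡ-≤ S aₘ 0 (≤-trans S+aₘ≤F′+B (≤-trans F′+B≤S (≤-reflexive (sym (+-identityʳ S)))))) ,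
  ≤-trans (m≤m+n S aₘ) S+aₘ≤F′+B
  where
  open +-*-Solver using (solve; _:+_; _:=_; con)
  S+aₘ≤F′+B : S + aₘ ≤ F′ + B
  S+aₘ≤F′+B = +-cancelˡ-≤ (k + k) _ _ (begin
    k + k + (S + aₘ)                ≡⟨ +-assoc (k + k) S aₘ ⟨
    k + k + S + aₘ                  ≡⟨ cong (_+ aₘ) total ⟩
    suc m + aₘ                      ≤⟨ +-monoˡ-≤ aₘ (s≤s covered) ⟩
    suc (aᵢ + aₛ + F + B) + aₘ      ≡⟨ solve 5 (λ aᵢ aₛ F B aₘ → con 1 :+ (aᵢ :+ aₛ :+ F :+ B) :+ aₘ
                                                 := (aᵢ :+ aₘ) :+ (con 1 :+ aₛ) :+ (F :+ B)) refl aᵢ aₛ F B aₘ ⟩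
    (aᵢ + aₘ) + (1 + aₛ) + (F + B)  ≡⟨ cong₂ (λ x y → x + y + (F + B)) aᵢ+aₘ≡k 1+aₛ≡k ⟩
    k + k + (F + B)                 ≤⟨ +-monoʳ-≤ (k + k) (+-monoˡ-≤ B F≤F′) ⟩
    k + k + (F′ + B)                ∎)
    where open ≤-Reasoning

module PathCover {G : Graph} {k : ℕ} {A : Fin k → Fin (Graph.n G)} (A-inj : Injective _≡_ _≡_ A)
                 (H : PathComponents G k A) where
  open Graph G using (n)
  open PathComponents H

  InA : Fin n → Set
  InA v = ∃ λ t → A t ≡ v

  InA? : ∀ v → Dec (InA v)
  InA? v = any? (λ t → A t ≟ᶠ v)

  p∉A : ∀ {j b} → ¬ InA (p j b)
  p∉A {j} {b} (t , At≡p) = p-notA j b t (sym At≡p)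

  Position : Set
  Position = Σ (Fin k) λ j → Fin (suc (len j))

  p-injective : ∀ {i a j b} → p i a ≡ p j b → _≡_ {A = Position} (i , a) (j , b)
  p-injective {i} {a} {j} {b} eq with p-inj i a j b eq
  ... | refl , a≡b = cong (i ,_) (toℕ-injective a≡b)

  locate : ∀ {v} → ¬ InA v → ∃ λ j → ∃ λ b → p j b ≡ v
  locate v∉A = p-cover _ (λ t v≡At → v∉A (t , sym v≡At))

  PathSucc : Fin n → Fin n → Set
  PathSucc x y = ∃ λ j → ∃ λ b → ∃ λ b′ → p j b ≡ x × p j b′ ≡ y × suc (toℕ b) ≡ toℕ b′

  PathSucc? : ∀ x y → Dec (PathSucc x y)
  PathSucc? x y = any? λ j → any? λ b → any? λ b′ →
    (p j b ≟ᶠ x) ×-dec (p j b′ ≟ᶠ y) ×-dec (suc (toℕ b) ≟ toℕ b′)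

  PathSucc-functional : ∀ {x y y′} → PathSucc x y → PathSucc x y′ → y ≡ y′
  PathSucc-functional (j , b , b′ , x≡ , y≡ , b+1≡b′) (_ , c , c′ , x≡′ , y′≡ , c+1≡c′)
    with p-injective (trans x≡ (sym x≡′))
  ... | refl = trans (sym y≡) (trans (cong (p j) (toℕ-injective (trans (sym b+1≡b′) c+1≡c′))) y′≡)

  E⇒PathSucc : ∀ {x y} → E G x y → ¬ InA x → ¬ InA y → PathSucc x y ⊎ PathSucc y x
  E⇒PathSucc {x} {y} xy∈E x∉A y∉A with locate x∉A | locate y∉A
  ... | j , b , pb≡x | j′ , b′ , pb′≡y with j ≟ᶠ j′
  ...   | no j≢j′  = contradiction (subst₂ (E G) (sym pb≡x) (sym pb′≡y) xy∈E) (p-noedge j j′ b b′ j≢j′)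
  ...   | yes refl with Equivalence.to (p-path j b b′) (subst₂ (E G) (sym pb≡x) (sym pb′≡y) xy∈E)
  ...     | inj₁ b+1≡b′ = inj₁ (j , b , b′ , pb≡x , pb′≡y , b+1≡b′)
  ...     | inj₂ b′+1≡b = inj₂ (j , b′ , b , pb′≡y , pb≡x , b′+1≡b)

  HasSucc : Fin n → Set
  HasSucc x = ∃ (PathSucc x)

  HasSucc? : ∀ x → Dec (HasSucc x)
  HasSucc? x = any? (PathSucc? x)

  IsLast : Fin n → Set
  IsLast v = ∃ λ j → p j (fromℕ (len j)) ≡ v

  IsLast? : ∀ v → Dec (IsLast v)
  IsLast? v = any? (λ j → p j (fromℕ (len j)) ≟ᶠ v)

  vertex-trichotomy : ∀ v → 𝟙 (InA? v) + 𝟙 (IsLast? v) + 𝟙 (HasSucc? v) ≡ 1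
  vertex-trichotomy v with InA? v
  ... | yes v∈A = cong₂ _+_
          (cong suc (𝟙-no (IsLast? v) λ { (_ , p≡v) → p∉A (subst InA (sym p≡v) v∈A) }))
          (𝟙-no (HasSucc? v) λ { (_ , _ , _ , _ , p≡v , _) → p∉A (subst InA (sym p≡v) v∈A) })
  ... | no v∉A with locate v∉A
  ...   | j , b , pb≡v with toℕ b ≟ len j
  ...     | yes b≡len = cong₂ _+_
              (𝟙-yes (IsLast? v) (j , trans (cong (p j) (toℕ-injective (trans (toℕ-fromℕ _) (sym b≡len)))) pb≡v))
              (𝟙-no (HasSucc? v) no-succ)
    where
    no-succ : ¬ HasSucc v
    no-succ (_ , _ , c , c′ , pc≡v , _ , c+1≡c′) with p-injective (trans pc≡v (sym pb≡v))
    ... | refl = <-irrefl refl (≤-trans (≤-reflexive (trans (cong suc (sym b≡len)) c+1≡c′)) (toℕ≤pred[n] c′))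
  ...     | no b≢len = cong₂ _+_
              (𝟙-no (IsLast? v) not-last)
              (𝟙-yes (HasSucc? v) (_ , j , b , fromℕ< (s≤s b<len) , pb≡v , refl , sym (toℕ-fromℕ< (s≤s b<len))))
    where
    b<len : toℕ b < len j
    b<len = ≤∧≢⇒< (toℕ≤pred[n] b) b≢len
    not-last : ¬ IsLast v
    not-last (_ , pl≡v) with p-injective (trans pl≡v (sym pb≡v))
    ... | refl = b≢len (toℕ-fromℕ _)

  ∑-HasSucc : k + k + ∑[ v < n ] 𝟙 (HasSucc? v) ≡ n
  ∑-HasSucc = begin
    k + k + ∑[ v < n ] 𝟙 (HasSucc? v)
      ≡⟨ cong₂ (λ a b → a + b + ∑[ v < n ] 𝟙 (HasSucc? v))
               (sym (∑-𝟙-image A A-inj))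
               (sym (∑-𝟙-image (λ j → p j (fromℕ (len j))) (cong proj₁ ∘ p-injective))) ⟩
    ∑[ v < n ] 𝟙 (InA? v) + ∑[ v < n ] 𝟙 (IsLast? v) + ∑[ v < n ] 𝟙 (HasSucc? v)
      ≡⟨ cong (_+ ∑[ v < n ] 𝟙 (HasSucc? v)) (∑-distrib-+ (𝟙 ∘ InA?) (𝟙 ∘ IsLast?)) ⟨
    ∑[ v < n ] (𝟙 (InA? v) + 𝟙 (IsLast? v)) + ∑[ v < n ] 𝟙 (HasSucc? v)
      ≡⟨ ∑-distrib-+ _ (𝟙 ∘ HasSucc?) ⟨
    ∑[ v < n ] (𝟙 (InA? v) + 𝟙 (IsLast? v) + 𝟙 (HasSucc? v))
      ≡⟨ sum-cong-≗ vertex-trichotomy ⟩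
    ∑[ v < n ] 1
      ≡⟨ trans (∑-const n 1) (*-identityʳ n) ⟩
    n ∎
    where open ≡-Reasoning

  module HamPathFromA {f : ℕ → Fin n} (hp : IsHamPath G f) (start∈A : InA (f 0)) where
    open IsHamPath hp

    -- A path edge traversed by f is charged to its earlier vertex on its path, forwards or backwards.
    fwd bwd : ℕ → ℕ
    fwd i       = 𝟙 ((suc i <? n) ×-dec PathSucc? (f i) (f (suc i)))
    bwd zero    = 0
    bwd (suc i) = 𝟙 (PathSucc? (f (suc i)) (f i))

    pair-covered : ∀ {i} → suc i < n → 1 ≤ 𝟙 (InA? (f i)) + 𝟙 (InA? (f (suc i))) + fwd i + bwd (suc i)
    pair-covered {i} i+1<n with InA? (f i) | InA? (f (suc i))
    ... | yes _   | _        = s≤s z≤n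
    ... | no _    | yes _    = s≤s z≤n
    ... | no fi∉A | no fi+1∉A with E⇒PathSucc (adjacent i+1<n) fi∉A fi+1∉A
    ...   | inj₁ s = ≤-trans (≤-reflexive (sym (𝟙-yes ((suc i <? n) ×-dec PathSucc? _ _) (i+1<n , s)))) (m≤m+n _ _)
    ...   | inj₂ s = ≤-trans (≤-reflexive (sym (𝟙-yes (PathSucc? _ _) s))) (m≤n+m _ _)

    fwd+bwd≤HasSucc : ∀ i → fwd i + bwd i ≤ 𝟙 (HasSucc? (f i))
    fwd+bwd≤HasSucc i with (suc i <? n) ×-dec PathSucc? (f i) (f (suc i))
    fwd+bwd≤HasSucc zero    | yes (_ , s) = ≤-reflexive (sym (𝟙-yes (HasSucc? _) (_ , s)))
    fwd+bwd≤HasSucc (suc i) | yes (i+2<n , s) with PathSucc? (f (suc i)) (f i)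
    ... | yes s′ = contradiction (injective i+2<n (<-trans (n<1+n i) (<-trans (n<1+n (suc i)) i+2<n))
                                   (PathSucc-functional s s′)) (λ ())
    ... | no _   = ≤-reflexive (sym (𝟙-yes (HasSucc? _) (_ , s)))
    fwd+bwd≤HasSucc zero    | no _ = z≤n
    fwd+bwd≤HasSucc (suc i) | no _ = 𝟙-mono (_ ,_) (PathSucc? (f (suc i)) (f i)) (HasSucc? (f (suc i)))

    module Count (m : ℕ) (n≡1+m : n ≡ suc m) where
      a : ℕ → ℕ
      a i = 𝟙 (InA? (f i))

      hs : ℕ → ℕ
      hs i = 𝟙 (HasSucc? (f i))

      ∑a≡k : ∑[ i < suc m ] a (toℕ i) ≡ k
      ∑a≡k = trans (∑-positions G hp n≡1+m (𝟙 ∘ InA?)) (∑-𝟙-image A A-inj)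

      k+k+∑hs≡1+m : k + k + ∑[ i < suc m ] hs (toℕ i) ≡ suc m
      k+k+∑hs≡1+m = trans (cong (k + k +_) (∑-positions G hp n≡1+m (𝟙 ∘ HasSucc?))) (trans ∑-HasSucc n≡1+m)

      pairs-covered : m ≤ ∑[ i < m ] a (toℕ i) + ∑[ i < m ] a (suc (toℕ i))
                          + ∑[ i < m ] fwd (toℕ i) + ∑[ i < suc m ] bwd (toℕ i)
      pairs-covered = begin
        m                    ≡⟨ trans (∑-const m 1) (*-identityʳ m) ⟨
        ∑[ i < m ] 1         ≤⟨ ∑-mono-≤ (λ i → pair-covered (subst (suc (suc (toℕ i)) ≤_) (sym n≡1+m)
                                                                     (s≤s (toℕ<n i)))) ⟩
        ∑[ i < m ] (a (toℕ i) + a (suc (toℕ i)) + fwd (toℕ i) + bwd (suc (toℕ i)))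
                             ≡⟨ ∑-distrib-+₄ {m} (a ∘ toℕ) (a ∘ suc ∘ toℕ) (fwd ∘ toℕ) (bwd ∘ suc ∘ toℕ) ⟩
        ∑[ i < m ] a (toℕ i) + ∑[ i < m ] a (suc (toℕ i))
          + ∑[ i < m ] fwd (toℕ i) + ∑[ i < m ] bwd (suc (toℕ i)) ∎
        where open ≤-Reasoning

      fwd+bwd≤hs : ∑[ i < suc m ] fwd (toℕ i) + ∑[ i < suc m ] bwd (toℕ i) ≤ ∑[ i < suc m ] hs (toℕ i)
      fwd+bwd≤hs = ≤-trans (≤-reflexive (sym (∑-distrib-+ {suc m} (fwd ∘ toℕ) (bwd ∘ toℕ))))
                           (∑-mono-≤ {suc m} (fwd+bwd≤HasSucc ∘ toℕ))

      tight : 𝟙 (InA? (f m)) ≡ 0 ×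
              ∑[ i < suc m ] hs (toℕ i) ≤ ∑[ i < suc m ] fwd (toℕ i) + ∑[ i < suc m ] bwd (toℕ i)
      tight = tight-count pairs-covered
                (trans (sym (∑-last m a)) ∑a≡k)
                (subst (λ x → x + ∑[ i < m ] a (suc (toℕ i)) ≡ k) a₀≡1 ∑a≡k)
                (≤-trans (m≤m+n _ (fwd m)) (≤-reflexive (sym (∑-last m fwd))))
                fwd+bwd≤hs k+k+∑hs≡1+m
        where
        a₀≡1 : a 0 ≡ 1
        a₀≡1 = 𝟙-yes (InA? (f 0)) start∈A

    end∉A : ∀ {m} → n ≡ suc m → ¬ InA (f m)
    end∉A {m} n≡1+m fm∈A = 0≢1+n (trans (sym (proj₁ (Count.tight m n≡1+m))) (𝟙-yes (InA? (f m)) fm∈A))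

    fwd+bwd≡HasSucc : ∀ {i} → i < n → fwd i + bwd i ≡ 𝟙 (HasSucc? (f i))
    fwd+bwd≡HasSucc {i} i<n with fin⇒suc (f 0)
    ... | m , n≡1+m = subst (λ x → fwd x + bwd x ≡ 𝟙 (HasSucc? (f x))) (toℕ-fromℕ< i<m+1)
        (∑-mono-≤-equality {suc m} (fwd+bwd≤HasSucc ∘ toℕ)
          (≤-trans (proj₂ (Count.tight m n≡1+m))
                   (≤-reflexive (sym (∑-distrib-+ {suc m} (fwd ∘ toℕ) (bwd ∘ toℕ)))))
          (fromℕ< i<m+1))
      where
      i<m+1 : i < suc m
      i<m+1 = subst (i <_) n≡1+m i<n

    successor-adjacent : ∀ {j y} → j < n → PathSucc (f j) y → Step G f (f j) y ⊎ Step G f y (f j)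
    successor-adjacent {j} {y} j<n s = decide ((suc j <? n) ×-dec PathSucc? (f j) (f (suc j)))
      where
      fwd+bwd≡1 : fwd j + bwd j ≡ 1
      fwd+bwd≡1 = trans (fwd+bwd≡HasSucc j<n) (𝟙-yes (HasSucc? (f j)) (y , s))
      backward : ∀ j → j < n → PathSucc (f j) y → bwd j ≡ 1 → Step G f y (f j)
      backward zero     _   _ ()
      backward (suc j′) j<n s bwd≡1 = j′ , j<n , PathSucc-functional (𝟙≡1⇒ (PathSucc? _ _) bwd≡1) s , refl
      decide : Dec (suc j < n × PathSucc (f j) (f (suc j))) → Step G f (f j) y ⊎ Step G f y (f j)
      decide (yes (j+1<n , s′)) = inj₁ (j , j+1<n , refl , PathSucc-functional s′ s)
      decide (no ¬fwd)          = inj₂ (backward j j<n s (trans (cong (_+ bwd j) (sym (𝟙-no _ ¬fwd))) fwd+bwd≡1))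

    path-succ-traversed : ∀ {x y} → PathSucc x y → Step G f x y ⊎ Step G f y x
    path-succ-traversed {x} {y} s with injective⇒surjective (positions-injective G hp) x
    ... | i , refl = successor-adjacent (toℕ<n i) s

  HamCycle-outside-A : Fin k → ∀ {M} → HamCycle G M → ∀ {x y} → ¬ InA x → ¬ InA y →
                       InE G M x y ⇔ (PathSucc x y ⊎ PathSucc y x)
  HamCycle-outside-A t₀ {M} hc x∉A y∉A = mk⇔
    (λ xy∈M → E⇒PathSucc (M⊆E xy∈M) x∉A y∉A)
    [ traversed⇒InE ∘ path-succ-traversed , InE-sym ∘ traversed⇒InE ∘ path-succ-traversed ]
    where
    instance
      n≢0 : NonZero (Graph.n G)
      n≢0 = >-nonZero (≤-trans (s≤s z≤n) (proj₁ hc))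
    open FromHamCycle {M = M} hc
    r : ℕ
    r = proj₁ (path-through (A t₀))
    open HamPathFromA (path-from-isHamPath r) (t₀ , sym (proj₂ (path-through (A t₀))))
    traversed⇒InE : ∀ {x y} → Step G (path-from r) x y ⊎ Step G (path-from r) y x → InE G M x y
    traversed⇒InE = [ Step⇒InE r , InE-sym ∘ Step⇒InE r ]

  record Traversal (j : Fin k) (u : Fin n) : Set where
    field
      q         : ℕ → Fin n
      start     : q 0 ≡ u
      on-path   : ∀ m → ∃ λ c → q m ≡ p j c
      covers    : ∀ c → ∃ λ m → m ≤ len j × q m ≡ p j c
      injective : ∀ {m m′} → m ≤ len j → m′ ≤ len j → q m ≡ q m′ → m ≡ m′
      steps     : ∀ {m} → m < len j → PathSucc (q m) (q (suc m)) ⊎ PathSucc (q (suc m)) (q m)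

  endpoint-traversal : ∀ {j u} → IsEndpoint j u → Traversal j u
  endpoint-traversal {j} (inj₁ u≡first) = record
    { q         = p j ∘ clamp (len j)
    ; start     = sym u≡first
    ; on-path   = λ m → clamp (len j) m , refl
    ; covers    = λ c → toℕ c , toℕ≤pred[n]′ c , cong (p j) (toℕ-injective (toℕ-clamp (toℕ≤pred[n]′ c)))
    ; injective = λ m≤L m′≤L q≡ →
                    trans (sym (toℕ-clamp m≤L)) (trans (proj₂ (p-inj j _ j _ q≡)) (toℕ-clamp m′≤L))
    ; steps     = λ {m} m<L → inj₁ (j , _ , _ , refl , refl ,
                    trans (cong suc (toℕ-clamp (<⇒≤ m<L))) (sym (toℕ-clamp m<L)))
    }
  endpoint-traversal {j} (inj₂ u≡last) = record
    { q         = p j ∘ opposite ∘ clamp (len j)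
    ; start     = trans (cong (p j) (toℕ-injective (trans (toℕ-opposite-clamp z≤n) (sym (toℕ-fromℕ L))))) (sym u≡last)
    ; on-path   = λ m → opposite (clamp L m) , refl
    ; covers    = λ c → L ∸ toℕ c , m∸n≤m L (toℕ c) , cong (p j) (toℕ-injective (begin
                    toℕ (opposite (clamp L (L ∸ toℕ c)))  ≡⟨ toℕ-opposite-clamp (m∸n≤m L (toℕ c)) ⟩
                    L ∸ (L ∸ toℕ c)                       ≡⟨ m∸[m∸n]≡n (toℕ≤pred[n]′ c) ⟩
                    toℕ c                                 ∎))
    ; injective = λ m≤L m′≤L q≡ → ∸-cancelˡ-≡ m≤L m′≤L
                    (trans (sym (toℕ-opposite-clamp m≤L))
                           (trans (proj₂ (p-inj j _ j _ q≡)) (toℕ-opposite-clamp m′≤L)))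
    ; steps     = λ {m} m<L → inj₂ (j , _ , _ , refl , refl , (begin
                    suc (toℕ (opposite (clamp L (suc m))))  ≡⟨ cong suc (toℕ-opposite-clamp m<L) ⟩
                    suc (L ∸ suc m)                         ≡⟨ +-∸-assoc 1 m<L ⟨
                    L ∸ m                                   ≡⟨ toℕ-opposite-clamp (<⇒≤ m<L) ⟨
                    toℕ (opposite (clamp L m))              ∎))
    }
    where
    open ≡-Reasoning
    L : ℕ
    L = len j
    toℕ-opposite-clamp : ∀ {m} → m ≤ L → toℕ (opposite (clamp L m)) ≡ L ∸ m
    toℕ-opposite-clamp {m} m≤L = trans (opposite-prop (clamp L m)) (cong (L ∸_) (toℕ-clamp m≤L))

  endpoint-or-interior : ∀ j b → IsEndpoint j (p j b) ⊎ ∃₂ λ x y → x ≢ y × PathSucc x (p j b) × PathSucc (p j b) y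
  endpoint-or-interior j zero    = inj₁ (inj₁ refl)
  endpoint-or-interior j (suc b) with suc (toℕ b) ≟ len j
  ... | yes b+1≡L = inj₁ (inj₂ (cong (p j) (toℕ-injective (trans b+1≡L (sym (toℕ-fromℕ (len j)))))))
  ... | no  b+1≢L = inj₂ (p j (inject₁ b) , p j (fromℕ< (s≤s b+1<L)) , x≢y ,
                          (j , inject₁ b , suc b , refl , refl , cong suc (toℕ-inject₁ b)) ,
                          (j , suc b , fromℕ< (s≤s b+1<L) , refl , refl , sym (toℕ-fromℕ< (s≤s b+1<L))))
    where
    b+1<L : suc (toℕ b) < len j
    b+1<L = ≤∧≢⇒< (toℕ≤pred[n]′ (suc b)) b+1≢L
    x≢y : p j (inject₁ b) ≢ p j (fromℕ< (s≤s b+1<L))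
    x≢y eq = contradiction (trans (sym (toℕ-inject₁ b)) (trans (proj₂ (p-inj j _ j _ eq)) (toℕ-fromℕ< (s≤s b+1<L))))
                           (λ b≡b+2 → <-irrefl b≡b+2 (<-trans (n<1+n (toℕ b)) (n<1+n (suc (toℕ b)))))

  module _ {f : ℕ → Fin n} (hp : IsHamPath G f) (start∈A : InA (f 0)) where
    open IsHamPath hp
    open HamPathFromA hp start∈A using (path-succ-traversed; end∉A)

    traversed : ∀ {x y} → PathSucc x y ⊎ PathSucc y x → Step G f x y ⊎ Step G f y x
    traversed (inj₁ s) = path-succ-traversed s
    traversed (inj₂ s) = swap (path-succ-traversed s)

    module _ {j u} (T : Traversal j u) (f1≡u : f 1 ≡ u) (1<n : 1 < n) where
      open Traversal T renaming (injective to q-injective)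

      follows : ∀ m → m ≤ len j → suc m < n × f (suc m) ≡ q m
      not-before : ∀ m → suc m ≤ len j → f m ≢ q (suc m)

      follows zero    _     = 1<n , trans f1≡u (sym start)
      follows (suc m) m+1≤L = step (traversed (steps m+1≤L))
        where
        m+1<n : suc m < n
        m+1<n = proj₁ (follows m (<⇒≤ m+1≤L))
        fm+1≡qm : f (suc m) ≡ q m
        fm+1≡qm = proj₂ (follows m (<⇒≤ m+1≤L))
        step : Step G f (q m) (q (suc m)) ⊎ Step G f (q (suc m)) (q m) → suc (suc m) < n × f (suc (suc m)) ≡ q (suc m)
        step (inj₁ (i , i+1<n , fi≡qm , fi+1≡qm+1))
          with injective (<-trans (n<1+n i) i+1<n) m+1<n (trans fi≡qm (sym fm+1≡qm))
        ... | refl = i+1<n , fi+1≡qm+1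
        step (inj₂ (i , i+1<n , fi≡qm+1 , fi+1≡qm)) with injective i+1<n m+1<n (trans fi+1≡qm (sym fm+1≡qm))
        ... | refl = contradiction fi≡qm+1 (not-before m m+1≤L)

      not-before zero    _      f0≡q1     = p∉A (subst InA (trans f0≡q1 (proj₂ (on-path 1))) start∈A)
      not-before (suc m) m+2≤L fm+1≡qm+2 = <-irrefl m≡m+2 (n≤1+n (suc m))
        where
        m≤L : m ≤ len j
        m≤L = ≤-trans (n≤1+n m) (≤-trans (n≤1+n (suc m)) m+2≤L)
        m≡m+2 : m ≡ suc (suc m)
        m≡m+2 = q-injective m≤L m+2≤L (trans (sym (proj₂ (follows m m≤L))) fm+1≡qm+2)

    module _ {n₃ : ℕ} (n≡3+n₃ : n ≡ 3 + n₃) where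
      N<n : 2 + n₃ < n
      N<n = ≤-reflexive (sym n≡3+n₃)

      neighbour-of-end : ∀ {y} → Step G f (f (2 + n₃)) y ⊎ Step G f y (f (2 + n₃)) → y ≡ f (1 + n₃)
      neighbour-of-end (inj₁ (i , i+1<n , fi≡fN , _)) with injective (<-trans (n<1+n i) i+1<n) N<n fi≡fN
      ... | refl = contradiction i+1<n (<-irrefl (sym n≡3+n₃))
      neighbour-of-end (inj₂ (i , i+1<n , fi≡y , fi+1≡fN)) with injective i+1<n N<n fi+1≡fN
      ... | refl = sym fi≡y

      end-is-endpoint : ∃ λ j → IsEndpoint j (f (2 + n₃))
      end-is-endpoint = from-location (locate (end∉A n≡3+n₃))
        where
        z : Fin n
        z = f (2 + n₃)
        from-location : (∃ λ j → ∃ λ b → p j b ≡ z) → ∃ λ j → IsEndpoint j z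
        from-location (j , b , pjb≡z) = from-shape (endpoint-or-interior j b)
          where
          from-shape : IsEndpoint j (p j b) ⊎ (∃₂ λ x y → x ≢ y × PathSucc x (p j b) × PathSucc (p j b) y) →
                       ∃ λ j → IsEndpoint j z
          from-shape (inj₁ endpoint) = j , subst (IsEndpoint j) pjb≡z endpoint
          from-shape (inj₂ (x , y , x≢y , x→z , z→y)) = contradiction (trans x≡pred (sym y≡pred)) x≢y
            where
            x≡pred : x ≡ f (1 + n₃)
            x≡pred = neighbour-of-end (subst (λ v → Step G f v x ⊎ Step G f x v) pjb≡z (swap (path-succ-traversed x→z)))
            y≡pred : y ≡ f (1 + n₃)
            y≡pred = neighbour-of-end (subst (λ v → Step G f v y ⊎ Step G f y v) pjb≡z (path-succ-traversed z→y))

      module _ {last u} (2≤k : 2 ≤ k) (last≡k-1 : suc (toℕ last) ≡ k)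
               (u-end : IsEndpoint last u) (f1≡u : f 1 ≡ u) where
        open Traversal (endpoint-traversal u-end) renaming (injective to q-injective)

        end-not-on-last-path : ∀ c → p last c ≢ f (2 + n₃)
        end-not-on-last-path c pc≡z = at-position (toℕ i) (toℕ<n i) fi≡p
          where
          1<n : 1 < n
          1<n = subst (1 <_) (sym n≡3+n₃) (s≤s (s≤s z≤n))
          m₀ : ℕ
          m₀ = proj₁ (covers c)
          m₀≤L : m₀ ≤ len last
          m₀≤L = proj₁ (proj₂ (covers c))
          walk : ∀ m → m ≤ len last → suc m < n × f (suc m) ≡ q m
          walk = follows (endpoint-traversal u-end) f1≡u 1<n
          m₀+1≡N : suc m₀ ≡ 2 + n₃
          m₀+1≡N = injective (proj₁ (walk m₀ m₀≤L)) N<n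
                             (trans (proj₂ (walk m₀ m₀≤L)) (trans (proj₂ (proj₂ (covers c))) pc≡z))
          j₀ : Fin k
          j₀ = fromℕ< (≤-trans (s≤s z≤n) 2≤k)
          j₀≢last : j₀ ≢ last
          j₀≢last j₀≡last =
            contradiction (subst (2 ≤_) (trans (sym last≡k-1) (cong suc (sym 0≡last))) 2≤k) λ { (s≤s ()) }
            where
            0≡last : 0 ≡ toℕ last
            0≡last = trans (sym (toℕ-fromℕ< (≤-trans (s≤s z≤n) 2≤k))) (cong toℕ j₀≡last)
          i : Fin n
          i = proj₁ (injective⇒surjective (positions-injective G hp) (p j₀ zero))
          fi≡p : f (toℕ i) ≡ p j₀ zero
          fi≡p = proj₂ (injective⇒surjective (positions-injective G hp) (p j₀ zero))
          at-position : ∀ t → t < n → f t ≢ p j₀ zero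
          at-position zero    _   f0≡p = p∉A (subst InA f0≡p start∈A)
          at-position (suc t) t+1<n ft+1≡p = j₀≢last (sym (proj₁ (p-inj last _ j₀ zero
            (trans (sym (proj₂ (on-path t))) (trans (sym (proj₂ (walk t t≤L))) ft+1≡p)))))
            where
            t≤L : t ≤ len last
            t≤L = ≤-trans (s≤s⁻¹ (s≤s⁻¹ (subst (suc (suc t) ≤_) (trans n≡3+n₃ (cong suc (sym m₀+1≡N))) t+1<n)))
                          m₀≤L

        end-is-earlier-endpoint : ∃ λ j → suc (toℕ j) < k × IsEndpoint j (f (2 + n₃))
        end-is-earlier-endpoint = earlier end-is-endpoint
          where
          earlier : (∃ λ j → IsEndpoint j (f (2 + n₃))) → ∃ λ j → suc (toℕ j) < k × IsEndpoint j (f (2 + n₃))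
          earlier (j , z-end) = j , subst (suc (toℕ j) <_) last≡k-1 (s≤s (≤∧≢⇒< j≤last j≢last)) , z-end
            where
            j≤last : toℕ j ≤ toℕ last
            j≤last = s≤s⁻¹ (subst (toℕ j <_) (sym last≡k-1) (toℕ<n j))
            not-last-path : j ≢ last
            not-last-path refl = [ end-not-on-last-path zero ∘ sym , end-not-on-last-path _ ∘ sym ] z-end
            j≢last : toℕ j ≢ toℕ last
            j≢last = not-last-path ∘ toℕ-injective

  PathSucc⇒PathEdge : ∀ {i c x y} → p i c ≡ x → PathSucc x y ⊎ PathSucc y x → PathEdge i x y
  PathSucc⇒PathEdge {i} {c} pic≡x (inj₁ (j , b , b′ , pjb≡x , pjb′≡y , b+1≡b′)) =
    edge (p-injective (trans pic≡x (sym pjb≡x)))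
    where
    edge : _≡_ {A = Position} (i , c) (j , b) → PathEdge i _ _
    edge refl = b , b′ , sym pjb≡x , sym pjb′≡y , inj₁ b+1≡b′
  PathSucc⇒PathEdge {i} {c} pic≡x (inj₂ (j , b , b′ , pjb≡y , pjb′≡x , b+1≡b′)) =
    edge (p-injective (trans pic≡x (sym pjb′≡x)))
    where
    edge : _≡_ {A = Position} (i , c) (j , b′) → PathEdge i _ _
    edge refl = b′ , b , sym pjb′≡x , sym pjb≡y , inj₂ b+1≡b′

  endpoint-on-path : ∀ {i u} → IsEndpoint i u → ∃ λ c → p i c ≡ u
  endpoint-on-path (inj₁ u≡first) = _ , sym u≡first
  endpoint-on-path (inj₂ u≡final) = _ , sym u≡final

  even-HamCycles-at-last-endpoint :
    2 ≤ k → 3 ≤ n → (∀ j z → suc (toℕ j) < k → IsEndpoint j z → Odd (deg G z)) →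
    ∀ {last u v} → suc (toℕ last) ≡ k → IsEndpoint last u → E G u v → ¬ PathEdge last u v →
    EvenlyManyHamCyclesThrough G u v
  even-HamCycles-at-last-endpoint 2≤k 3≤n odd-early-ends {last} {u} {v} last≡k-1 u-end uv∈E ¬path-edge =
    by-cases (InA? v)
    where
    n₃ : ℕ
    n₃ = proj₁ (m≤n⇒∃[o]m+o≡n 3≤n)
    n≡3+n₃ : n ≡ 3 + n₃
    n≡3+n₃ = sym (proj₂ (m≤n⇒∃[o]m+o≡n 3≤n))
    by-cases : Dec (InA v) → EvenlyManyHamCyclesThrough G u v
    by-cases (no v∉A) = contradiction (PathSucc⇒PathEdge pc≡u (E⇒PathSucc uv∈E u∉A v∉A)) ¬path-edge
      where
      pc≡u : p last (proj₁ (endpoint-on-path u-end)) ≡ u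
      pc≡u = proj₂ (endpoint-on-path u-end)
      u∉A : ¬ InA u
      u∉A u∈A = p∉A (subst InA (sym pc≡u) u∈A)
    by-cases (yes (t , At≡v)) = HamCyclesThrough.even-HamCycles-through G n≡3+n₃ v u
      (λ (hp , f0≡v , f1≡u) →
         odd-end (end-is-earlier-endpoint hp (t , trans At≡v (sym f0≡v)) n≡3+n₃ 2≤k last≡k-1 u-end f1≡u))
      where
      odd-end : ∀ {z} → (∃ λ j → suc (toℕ j) < k × IsEndpoint j z) → Odd (deg G z)
      odd-end (j , j<k-1 , z-end) = odd-early-ends j _ j<k-1 z-end

lemma2p4 : (k : ℕ) → 2 ≤ k → (G : Graph) → (C : EdgeSet G) → HamCycle G C →
    (A : Fin k → Fin (Graph.n G)) → Injective _≡_ _≡_ A →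
    (H : PathComponents G k A) →
    (∀ (i : Fin k) (u : Fin (Graph.n G)) → suc (toℕ i) < k →
      PathComponents.IsEndpoint H i u → Odd (deg G u)) →
    ((C′ : EdgeSet G) → HamCycle G C′ →
      ∀ u v → (∀ t → u ≢ A t) → (∀ t → v ≢ A t) → (InE G C′ u v ⇔ InE G C u v))
    × (∀ (i : Fin k) (u v : Fin (Graph.n G)) → suc (toℕ i) ≡ k →
        PathComponents.IsEndpoint H i u → E G u v → ¬ PathComponents.PathEdge H i u v →
        EvenlyManyHamCyclesThrough G u v)
lemma2p4 k 2≤k G C hC A A-inj H odd-early-ends =
  (λ C′ hC′ u v u≢A v≢A → ⇔-trans (HamCycle-outside-A t₀ {C′} hC′ (∉A u≢A) (∉A v≢A))
                                   (⇔-sym (HamCycle-outside-A t₀ {C} hC (∉A u≢A) (∉A v≢A)))) ,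
  (λ i u v last → even-HamCycles-at-last-endpoint 2≤k (proj₁ hC) odd-early-ends last)
  where
  open PathCover A-inj H
  t₀ : Fin k
  t₀ = fromℕ< (≤-trans (s≤s z≤n) 2≤k)
  ∉A : ∀ {v} → (∀ t → v ≢ A t) → ¬ InA v
  ∉A v≢A (t , At≡v) = v≢A t (sym At≡v)
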